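{- Let $R$ be a commutative ring, $L$ a finite meet semilattice with zeta function $\zeta$ and Möbius function $\mu$, and $X=\{x_1,\dots,x_n\}\subseteq L$. Let $\overline X=\{x_1,\dots,x_n,x_{n+1},\dots,x_{n+m}\}$ be the smallest factor-closed subset of $L$ containing $X$. For each $x\in X$ fix $z_x\in\overline X$ with $z_x\le x$ and a function $F_x:L\to R$, and put $f_x(y)=\sum_{w\le y}\mu(w,y)F_x(w)$. Let $k\ge2$ and $\mathcal F:\mathfrak S_n^{k-2}\to R$ any map, and let \[ DF(X)=\mathrm{Det}_{\mathcal F}\Big(F_{x_{i_1}}(z_{x_{i_1}}\wedge x_{i_2}\wedge\cdots\wedge x_{i_k})\Big)_{1\le i_1,\dots,i_k\le n}. \] Then \[ DF(X)=\sum_{1\le k_1<\cdots<k_n\le n+m}\mathrm{Det}_{\mathcal F}\Big(f_{x_{i_1}}(x_{k_{i_2}})\,\zeta\big(x_{k_{i_2}},z_{x_{i_1}}\wedge x_{i_3}\wedge\cdots\wedge x_{i_k}\big)\Big)_{1\le i_1,\dots,i_k\le n}\cdot\det\big(\zeta(x_{k_i},x_j)\big)_{1\le i,j\le n}. \]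
   Context: A meet semilattice is a poset in which every pair $x,y$ has a greatest lower bound $x\wedge y$. $\zeta(x,y)=1$ if $x\le y$ and $0$ otherwise; the Möbius function is $\mu(x,x)=1$, $\mu(x,y)=-\sum_{x\le z<y}\mu(z,y)$ if $x<y$, and $0$ otherwise. A subset $S\subseteq L$ is factor-closed if $y\in S$ and $x\le y$ imply $x\in S$. $\mathfrak S_n$ is the symmetric group on $\{1,\dots,n\}$. For $\mathcal F:\mathfrak S_n^{k-2}\to R$ and a hypermatrix $M=(M_{i_1,\dots,i_k})_{1\le i_j\le n}$, the $\mathcal F$-determinant is $\mathrm{Det}_{\mathcal F}(M)=\sum_{(\sigma_2,\dots,\sigma_k)\in\mathfrak S_n^{k-1}}\mathrm{sign}(\sigma_2)\mathcal F(\sigma_3,\dots,\sigma_k)\prod_{i=1}^n M_{i,\sigma_2(i),\dots,\sigma_k(i)}$. (In a hypermatrix with entries written in terms of $i_1,\dots,i_k$, the entry shown is the $(i_1,\dots,i_k)$ entry.) -}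

module Defs where

open import Level using (Level; 0ℓ; _⊔_) renaming (suc to lsuc)
open import Data.Nat using (ℕ; zero; suc) renaming (_<ᵇ_ to _<ᵇℕ_; _+_ to _+ℕ_)
open import Data.Bool using (Bool; true; false; _∧_; _∨_; not; if_then_else_)
import Data.Fin
open import Data.Fin using (Fin; toℕ; _↑ˡ_) renaming (_≟_ to _≟ᶠ_)
open import Data.List using (List; []; _∷_; [_]; map; concatMap; foldr; allFin; filterᵇ)
open import Data.Bool.ListAction using (and)
open import Data.Vec.Functional using (Vector) renaming ([] to []ᵛ; _∷_ to _∷ᵛ_)
open import Data.Product using (∃; _×_)
open import Relation.Nullary using (¬_; does)
open import Relation.Binary using (Rel; Decidable)
open import Relation.Binary.PropositionalEquality using (_≡_; _≢_)
open import Relation.Binary.Lattice.Structures using (IsMeetSemilattice)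
open import Algebra.Bundles using (CommutativeRing)

allVectors : ∀ {a} {A : Set a} → List A → (j : ℕ) → List (Vector A j)
allVectors xs zero    = [ []ᵛ ]
allVectors xs (suc j) = concatMap (λ a → map (a ∷ᵛ_) (allVectors xs j)) xs

allFuns : (a b : ℕ) → List (Fin a → Fin b)
allFuns a b = allVectors (allFin b) a

_<ᵇ_ : ∀ {n} → Fin n → Fin n → Bool
i <ᵇ j = toℕ i <ᵇℕ toℕ j

_==ᶠ_ : ∀ {n} → Fin n → Fin n → Bool
i ==ᶠ j = does (i ≟ᶠ j)

isInjectiveᵇ : ∀ {a b} → (Fin a → Fin b) → Bool
isInjectiveᵇ {a} σ =
  and (concatMap (λ i → map (λ j → not (σ i ==ᶠ σ j) ∨ (i ==ᶠ j)) (allFin a)) (allFin a))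

-- permutations of {1..n} are the injective (= bijective) maps Fin n → Fin n
Perm : ℕ → Set
Perm n = Fin n → Fin n

perms : (n : ℕ) → List (Perm n)
perms n = filterᵇ isInjectiveᵇ (allFuns n n)

isStrictIncᵇ : ∀ {n p} → (Fin n → Fin p) → Bool
isStrictIncᵇ {n} κ =
  and (concatMap (λ i → map (λ j → not (i <ᵇ j) ∨ (κ i <ᵇ κ j)) (allFin n)) (allFin n))

strictIncSeqs : (n p : ℕ) → List (Fin n → Fin p)
strictIncSeqs n p = filterᵇ isStrictIncᵇ (allFuns n p)

record FinMeetSemilattice (N : ℕ) : Set₁ where
  field
    _≤_               : Rel (Fin N) 0ℓ
    _≤?_              : Decidable _≤_
    _⊓_               : Fin N → Fin N → Fin N
    isMeetSemilattice : IsMeetSemilattice _≡_ _≤_ _⊓_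

module RingDefs {c ℓ : Level} (R : CommutativeRing c ℓ) where
  open CommutativeRing R

  sumList : ∀ {a} {A : Set a} → List A → (A → Carrier) → Carrier
  sumList xs f = foldr (λ x acc → f x + acc) 0# xs

  prodList : ∀ {a} {A : Set a} → List A → (A → Carrier) → Carrier
  prodList xs f = foldr (λ x acc → f x * acc) 1# xs

  sign : ∀ {n} → Perm n → Carrier
  sign {n} σ = prodList (allFin n) λ i → prodList (allFin n) λ j →
    if (i <ᵇ j) ∧ (σ j <ᵇ σ i) then - 1# else 1#

  det : (n : ℕ) → (Fin n → Fin n → Carrier) → Carrier
  det n M = sumList (perms n) λ σ → sign σ * prodList (allFin n) (λ i → M i (σ i))

  -- 𝓕-determinant of a k-hypermatrix, k = j + 2.
  -- The hypermatrix M is given as  M i₁ i₂ (i₃ , … , i_k)  with the last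
  -- k-2 indices packed in a vector  Fin j → Fin n.
  -- 𝓕 : 𝔖ₙ^(k-2) → R is given on (Fin j → Perm n).
  DetF : (n j : ℕ) → ((Fin j → Perm n) → Carrier) →
         (Fin n → Fin n → (Fin j → Fin n) → Carrier) → Carrier
  DetF n j 𝓕 M =
    sumList (perms n) λ σ₂ → sumList (allVectors (perms n) j) λ σs →
      sign σ₂ * 𝓕 σs * prodList (allFin n) (λ i → M i (σ₂ i) (λ t → σs t i))

  module Lattice {N : ℕ} (L : FinMeetSemilattice N) where
    open FinMeetSemilattice L

    elems : List (Fin N)
    elems = allFin N

    ζ : Fin N → Fin N → Carrier
    ζ x y = if does (x ≤? y) then 1# else 0#

    meetAll : ∀ {j} → Fin N → (Fin j → Fin N) → Fin N
    meetAll {zero}  a v = a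
    meetAll {suc j} a v = meetAll (a ⊓ v Data.Fin.zero) (λ t → v (Data.Fin.suc t))

    record IsMobius (μ : Fin N → Fin N → Carrier) : Set (c ⊔ ℓ) where
      field
        μ-refl : ∀ x → μ x x ≈ 1#
        μ-lt   : ∀ x y → x ≤ y → x ≢ y →
                 μ x y ≈ - sumList elems (λ z →
                   if does (x ≤? z) ∧ does (z ≤? y) ∧ not (z ==ᶠ y) then μ x z else 0#)
        μ-nle  : ∀ x y → ¬ (x ≤ y) → μ x y ≈ 0#

    FactorClosed : (Fin N → Set) → Set
    FactorClosed S = ∀ {x y} → S y → x ≤ y → S x

    -- the image of xbar : Fin (n +ℕ m) → L is the smallest factor-closed subset
    -- of L containing X = { xbar (i ↑ˡ m) | i : Fin n }
    IsFactorClosure : (n m : ℕ) → (Fin (n +ℕ m) → Fin N) → Set₁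
    IsFactorClosure n m xbar =
      FactorClosed (λ y → ∃ λ j → y ≡ xbar j) ×
      (∀ (S : Fin N → Set) → FactorClosed S → (∀ i → S (xbar (i ↑ˡ m))) →
         ∀ j → S (xbar j))

    fFrom : (Fin N → Fin N → Carrier) → (Fin N → Carrier) → Fin N → Carrier
    fFrom μ Fx y = sumList elems λ w → if does (w ≤? y) then μ w y * Fx w else 0#

    DF : (n m : ℕ) (xbar : Fin (n +ℕ m) → Fin N) (z : Fin n → Fin N)
         (F : Fin n → Fin N → Carrier) (j : ℕ) (𝓕 : (Fin j → Perm n) → Carrier) → Carrier
    DF n m xbar z F j 𝓕 =
      DetF n j 𝓕 λ i₁ i₂ is → F i₁ (meetAll (z i₁) (λ t → xs ((i₂ ∷ᵛ is) t)))
      where xs = λ (i : Fin n) → xbar (i ↑ˡ m)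

    RHS : (μ : Fin N → Fin N → Carrier)
          (n m : ℕ) (xbar : Fin (n +ℕ m) → Fin N) (z : Fin n → Fin N)
          (F : Fin n → Fin N → Carrier) (j : ℕ) (𝓕 : (Fin j → Perm n) → Carrier) → Carrier
    RHS μ n m xbar z F j 𝓕 =
      sumList (strictIncSeqs n (n +ℕ m)) λ κ →
        DetF n j 𝓕 (λ i₁ i₂ is →
            fFrom μ (F i₁) (xbar (κ i₂)) *
            ζ (xbar (κ i₂)) (meetAll (z i₁) (λ t → xs (is t))))
        * det n (λ i i' → ζ (xbar (κ i)) (xs i'))
      where xs = λ (i : Fin n) → xbar (i ↑ˡ m)

{-# OPTIONS --safe #-}

-- Möbius inversion gives F_x(w) = Σ_{y ≤ w} f_x(y).  For w = z_x ∧ x_{i₂} ∧ ⋯ ∧ x_{i_k} the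
-- condition y ≤ w splits into y ≤ z_x ∧ x_{i₃} ∧ ⋯ ∧ x_{i_k} and y ≤ x_{i₂}, and the first one
-- forces y ∈ X̄, because z_x ∈ X̄ and X̄ is factor-closed.  So for fixed σ₃, …, σ_k the matrix
-- (i₁, i₂) ↦ F_{x_{i₁}}(…) is the product of the n × (n+m) matrix
-- f_{x_{i₁}}(x_l) ζ(x_l, z_{x_{i₁}} ∧ x_{i₃} ∧ ⋯ ∧ x_{i_k}) and the (n+m) × n matrix ζ(x_l, x_{i₂}).
-- Det_𝓕 is a linear combination of ordinary determinants of such products, and the
-- Cauchy–Binet formula expands each of them over the index sets k₁ < ⋯ < kₙ.
--
-- Cauchy–Binet itself: expanding det(AB) multilinearly gives a sum over all maps
-- l : [n] → [n+m]; the terms with l not injective vanish because a determinant with two equal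
-- rows is 0, and every injective l factors uniquely as (increasing) ∘ (permutation), the
-- permutation recording the ranks of the values of l.

module Submission where

open import Level using (Level; 0ℓ)
open import Data.Nat as ℕ using (ℕ; zero; suc)
import Data.Nat.Properties as ℕ
open import Data.Bool using (Bool; true; false; not; _∧_; _∨_; _xor_; if_then_else_)
open import Data.Bool.Properties using (∧-commutativeMonoid; ⇔→≡; ¬-not; not-involutive; xor-same; if-∧)
open import Data.Fin as Fin using (Fin; zero; suc; toℕ; _↑ˡ_)
open import Data.Fin.Properties as Fin using (_≟_; _<?_)
open import Data.Fin.Permutation.Components using (transpose; transpose-inverse)
open import Data.List using (List; []; _∷_; map; concatMap; foldr; allFin; tabulate; filterᵇ; _++_)
open import Data.Bool.ListAction using (and)
open import Data.Vec.Functional using () renaming (_∷_ to _∷ᵛ_)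
open import Data.Product using (∃; ∃₂; _×_; _,_; proj₁; proj₂)
open import Data.Empty using (⊥-elim)
open import Function using (_∘_; id; _⇔_; mk⇔; Equivalence; _⟨_⟩_; case_of_)
import Function.Properties.Equivalence as ⇔
open import Function.Definitions using (Injective)
open import Relation.Nullary using (¬_; ¬?; Dec; yes; no; does)
open import Relation.Nullary.Decidable using (dec-true; dec-false; does-⇔; _×-dec_)
open import Relation.Binary using (DecSetoid; _Preserves_⟶_; tri<; tri≈; tri>)
open import Relation.Binary.PropositionalEquality as ≡ using (_≡_; _≢_; _≗_; refl)
open import Relation.Binary.Lattice.Structures using (IsMeetSemilattice)
open import Algebra.Bundles using (CommutativeMonoid; CommutativeRing)
import Relation.Binary.Reasoning.Setoid as ≈-Reasoning
open import Defs

does-true⇒ : ∀ {p} {P : Set p} (P? : Dec P) → does P? ≡ true → P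
does-true⇒ (yes p) _ = p

module _ {p} {P : Set p} (P? : Dec P) where

  if-yes : ∀ {a} {A : Set a} {x y : A} → P → (if does P? then x else y) ≡ x
  if-yes {x = x} {y} p = ≡.cong (if_then x else y) (dec-true P? p)

  if-no : ∀ {a} {A : Set a} {x y : A} → ¬ P → (if does P? then x else y) ≡ y
  if-no {x = x} {y} ¬p = ≡.cong (if_then x else y) (dec-false P? ¬p)

<ᵇ-irrefl : ∀ {n} (a : Fin n) → a <ᵇ a ≡ false
<ᵇ-irrefl a = dec-false (a <? a) (Fin.<-irrefl refl)

<ᵇ-flip : ∀ {n} {a b : Fin n} → a ≢ b → b <ᵇ a ≡ not (a <ᵇ b)
<ᵇ-flip {a = a} {b} a≢b with Fin.<-cmp a b
... | tri< a<b _ b≮a = ≡.trans (dec-false (b <? a) b≮a) (≡.cong not (≡.sym (dec-true (a <? b) a<b)))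
... | tri≈ _ a≡b _   = ⊥-elim (a≢b a≡b)
... | tri> a≮b _ b<a = ≡.trans (dec-true (b <? a) b<a) (≡.cong not (≡.sym (dec-false (a <? b) a≮b)))

<ᵇ-asym : ∀ {n} (a b : Fin n) → (a <ᵇ b) ∧ (b <ᵇ a) ≡ false
<ᵇ-asym a b with a <ᵇ b in a<b
... | true  = dec-false (b <? a) (Fin.<-asym (does-true⇒ (a <? b) a<b))
... | false = refl

-- Injections, permutations and increasing maps between finite sets

injective⇒onto : ∀ {n} {σ : Fin n → Fin n} → Injective _≡_ _≡_ σ → ∀ y → ∃ λ x → σ x ≡ y
injective⇒onto {suc n} {σ} σ-injective y with Fin.any? (λ x → σ x ≟ y)
... | yes hit = hit
... | no ¬hit = ⊥-elim (ℕ.1+n≰n (Fin.injective⇒≤ punchOut-injective))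
  where
  y≢σ : ∀ x → y ≢ σ x
  y≢σ x e = ¬hit (x , ≡.sym e)
  punchOut-injective : Injective _≡_ _≡_ (λ x → Fin.punchOut (y≢σ x))
  punchOut-injective e = σ-injective (Fin.punchOut-injective (y≢σ _) (y≢σ _) e)

collision : ∀ {n p} (l : Fin n → Fin p) → ¬ Injective _≡_ _≡_ l → ∃₂ λ i j → i ≢ j × l i ≡ l j
collision l ¬injective with Fin.any? (λ i → Fin.any? (λ j → ¬? (i ≟ j) ×-dec (l i ≟ l j)))
... | yes (i , j , i≢j , li≡lj) = i , j , i≢j , li≡lj
... | no ∄collision = ⊥-elim (¬injective injective)
  where
  injective : Injective _≡_ _≡_ l
  injective {i} {j} li≡lj with i ≟ j
  ... | yes i≡j = i≡j
  ... | no  i≢j = ⊥-elim (∄collision (i , j , i≢j , li≡lj))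

injective-cong : ∀ {n p} {σ σ′ : Fin n → Fin p} → σ ≗ σ′ → Injective _≡_ _≡_ σ → Injective _≡_ _≡_ σ′
injective-cong σ≗σ′ σ-injective {x} {y} e = σ-injective (≡.trans (σ≗σ′ x) (≡.trans e (≡.sym (σ≗σ′ y))))

module _ {n} (σ : Fin n → Fin n) (σ-injective : Injective _≡_ _≡_ σ) where

  inverse : Fin n → Fin n
  inverse y = proj₁ (injective⇒onto σ-injective y)

  inverseʳ : ∀ y → σ (inverse y) ≡ y
  inverseʳ y = proj₂ (injective⇒onto σ-injective y)

  inverseˡ : ∀ x → inverse (σ x) ≡ x
  inverseˡ x = σ-injective (inverseʳ (σ x))

  inverse-injective : Injective _≡_ _≡_ inverse
  inverse-injective {x} {y} e = ≡.trans (≡.sym (inverseʳ x)) (≡.trans (≡.cong σ e) (inverseʳ y))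

StrictlyIncreasing : ∀ {n p} → (Fin n → Fin p) → Set
StrictlyIncreasing κ = κ Preserves Fin._<_ ⟶ Fin._<_

strictlyIncreasing-cong : ∀ {n p} {κ κ′ : Fin n → Fin p} → κ ≗ κ′ → StrictlyIncreasing κ → StrictlyIncreasing κ′
strictlyIncreasing-cong κ≗κ′ κ-increasing {i} {j} i<j = ≡.subst₂ Fin._<_ (κ≗κ′ i) (κ≗κ′ j) (κ-increasing i<j)

module _ {n p} {κ : Fin n → Fin p} (κ-increasing : StrictlyIncreasing κ) where

  strictlyIncreasing-reflects-< : ∀ {a b} → κ a Fin.< κ b → a Fin.< b
  strictlyIncreasing-reflects-< {a} {b} κa<κb with Fin.<-cmp a b
  ... | tri< a<b _ _ = a<b
  ... | tri≈ _ refl _ = ⊥-elim (Fin.<-irrefl refl κa<κb)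
  ... | tri> _ _ b<a = ⊥-elim (Fin.<-asym κa<κb (κ-increasing b<a))

  strictlyIncreasing⇒injective : Injective _≡_ _≡_ κ
  strictlyIncreasing⇒injective {a} {b} κa≡κb with Fin.<-cmp a b
  ... | tri< a<b _ _ = ⊥-elim (Fin.<-irrefl κa≡κb (κ-increasing a<b))
  ... | tri≈ _ a≡b _ = a≡b
  ... | tri> _ _ b<a = ⊥-elim (Fin.<-irrefl (≡.sym κa≡κb) (κ-increasing b<a))

  strictlyIncreasing-<ᵇ : ∀ a b → κ a <ᵇ κ b ≡ a <ᵇ b
  strictlyIncreasing-<ᵇ a b = does-⇔ (mk⇔ strictlyIncreasing-reflects-< κ-increasing) (κ a <? κ b) (a <? b)

swap01 : ∀ {n} → Fin (suc (suc n)) → Fin (suc (suc n))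
swap01 zero          = suc zero
swap01 (suc zero)    = zero
swap01 (suc (suc k)) = suc (suc k)

swap01-involutive : ∀ {n} (k : Fin (suc (suc n))) → swap01 (swap01 k) ≡ k
swap01-involutive zero          = refl
swap01-involutive (suc zero)    = refl
swap01-involutive (suc (suc k)) = refl

swap01-injective : ∀ {n} → Injective _≡_ _≡_ (swap01 {n})
swap01-injective {x = x} {y} e = ≡.trans (≡.sym (swap01-involutive x)) (≡.trans (≡.cong swap01 e) (swap01-involutive y))

module _ {n : ℕ} where

  transpose-injective : ∀ (i j : Fin n) → Injective _≡_ _≡_ (transpose i j)
  transpose-injective i j {x} {y} e =
    ≡.trans (≡.sym (transpose-inverse j i)) (≡.trans (≡.cong (transpose j i) e) (transpose-inverse j i))

  transpose-matchˡ : ∀ (i j : Fin n) → transpose i j i ≡ j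
  transpose-matchˡ i j rewrite dec-true (i ≟ i) refl = refl

  transpose-fix : ∀ (i j k : Fin n) → k ≢ i → k ≢ j → transpose i j k ≡ k
  transpose-fix i j k k≢i k≢j rewrite dec-false (k ≟ i) k≢i | dec-false (k ≟ j) k≢j = refl

module _ {n : ℕ} (i j : Fin (suc (suc n))) where

  pairPerm : Fin (suc (suc n)) → Fin (suc (suc n))
  pairPerm = transpose zero i ∘ transpose (suc zero) (transpose i zero j)

  pairPerm-injective : Injective _≡_ _≡_ pairPerm
  pairPerm-injective = transpose-injective (suc zero) _ ∘ transpose-injective zero i

  pairPerm-one : pairPerm (suc zero) ≡ j
  pairPerm-one = ≡.trans (≡.cong (transpose zero i) (transpose-matchˡ (suc zero) (transpose i zero j))) (transpose-inverse zero i)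

  pairPerm-zero : i ≢ j → pairPerm zero ≡ i
  pairPerm-zero i≢j = ≡.trans (≡.cong (transpose zero i) (transpose-fix (suc zero) _ zero (λ ()) 0≢j′))
                              (transpose-matchˡ zero i)
    where
    0≢j′ : zero ≢ transpose i zero j
    0≢j′ e = i≢j (≡.trans (≡.sym (transpose-matchˡ zero i))
                   (≡.trans (≡.cong (transpose zero i) e) (transpose-inverse zero i)))

≗-decSetoid : ℕ → ℕ → DecSetoid 0ℓ 0ℓ
≗-decSetoid j p = record
  { Carrier          = Fin j → Fin p
  ; _≈_              = _≗_
  ; isDecEquivalence = record
    { isEquivalence = record
      { refl  = λ _ → refl
      ; sym   = λ e i → ≡.sym (e i)
      ; trans = λ e e′ i → ≡.trans (e i) (e′ i)
      }
    ; _≟_ = λ f g → Fin.all? (λ i → f i ≟ g i)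
    }
  }

-- Big operators over finite enumerations

module BigOperators {c ℓ} (M : CommutativeMonoid c ℓ) where
  open CommutativeMonoid M renaming (Carrier to A; refl to ≈-refl)
  open import Algebra.Properties.CommutativeSemigroup commutativeSemigroup using (interchange)
  open ≈-Reasoning setoid

  foldMap : ∀ {a} {I : Set a} → List I → (I → A) → A
  foldMap xs f = foldr (λ x acc → f x ∙ acc) ε xs

  module _ {a} {I : Set a} where

    foldMap-cong : ∀ (xs : List I) {f g : I → A} → (∀ x → f x ≈ g x) → foldMap xs f ≈ foldMap xs g
    foldMap-cong []       f≈g = ≈-refl
    foldMap-cong (x ∷ xs) f≈g = ∙-cong (f≈g x) (foldMap-cong xs f≈g)

    foldMap-ε : ∀ (xs : List I) {f : I → A} → (∀ x → f x ≈ ε) → foldMap xs f ≈ ε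
    foldMap-ε []       f≈ε = ≈-refl
    foldMap-ε (x ∷ xs) f≈ε = trans (∙-cong (f≈ε x) (foldMap-ε xs f≈ε)) (identityˡ ε)

    foldMap-∙ : ∀ (xs : List I) (f g : I → A) →
                foldMap xs (λ x → f x ∙ g x) ≈ foldMap xs f ∙ foldMap xs g
    foldMap-∙ []       f g = sym (identityˡ ε)
    foldMap-∙ (x ∷ xs) f g = trans (∙-congˡ (foldMap-∙ xs f g)) (interchange _ _ _ _)

    foldMap-++ : ∀ (xs ys : List I) (f : I → A) → foldMap (xs ++ ys) f ≈ foldMap xs f ∙ foldMap ys f
    foldMap-++ []       ys f = sym (identityˡ _)
    foldMap-++ (x ∷ xs) ys f = trans (∙-congˡ (foldMap-++ xs ys f)) (sym (assoc _ _ _))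

    foldMap-filterᵇ : ∀ (P : I → Bool) (xs : List I) (f : I → A) →
                      foldMap (filterᵇ P xs) f ≈ foldMap xs (λ x → if P x then f x else ε)
    foldMap-filterᵇ P []       f = ≈-refl
    foldMap-filterᵇ P (x ∷ xs) f with P x
    ... | true  = ∙-congˡ (foldMap-filterᵇ P xs f)
    ... | false = trans (foldMap-filterᵇ P xs f) (sym (identityˡ _))

  module _ {a b} {I : Set a} {J : Set b} where

    foldMap-map : ∀ (h : I → J) (xs : List I) (f : J → A) → foldMap (map h xs) f ≡ foldMap xs (f ∘ h)
    foldMap-map h []       f = refl
    foldMap-map h (x ∷ xs) f = ≡.cong (f (h x) ∙_) (foldMap-map h xs f)

    foldMap-concatMap : ∀ (g : I → List J) (xs : List I) (f : J → A) →
                        foldMap (concatMap g xs) f ≈ foldMap xs (λ x → foldMap (g x) f)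
    foldMap-concatMap g []       f = ≈-refl
    foldMap-concatMap g (x ∷ xs) f =
      trans (foldMap-++ (g x) (concatMap g xs) f) (∙-congˡ (foldMap-concatMap g xs f))

    foldMap-comm : ∀ (xs : List I) (ys : List J) (f : I → J → A) →
                   foldMap xs (λ x → foldMap ys (f x)) ≈ foldMap ys (λ y → foldMap xs (λ x → f x y))
    foldMap-comm []       ys f = sym (foldMap-ε ys (λ _ → ≈-refl))
    foldMap-comm (x ∷ xs) ys f =
      trans (∙-congˡ (foldMap-comm xs ys f)) (sym (foldMap-∙ ys (f x) _))

  foldMap-tabulate : ∀ {a} {I : Set a} {n} (g : Fin n → I) (f : I → A) →
                     foldMap (tabulate g) f ≡ foldMap (allFin n) (f ∘ g)
  foldMap-tabulate {n = zero}  g f = refl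
  foldMap-tabulate {n = suc n} g f = ≡.cong (f (g zero) ∙_)
    (≡.trans (foldMap-tabulate (g ∘ suc) f) (≡.sym (foldMap-tabulate suc (f ∘ g))))

  foldMap-allFin-suc : ∀ {n} (f : Fin (suc n) → A) →
                       foldMap (allFin (suc n)) f ≡ f zero ∙ foldMap (allFin n) (f ∘ suc)
  foldMap-allFin-suc f = ≡.cong (f zero ∙_) (foldMap-tabulate suc f)

  foldMap-allVectors-suc : ∀ {a} {I : Set a} (xs : List I) j (f : (Fin (suc j) → I) → A) →
    foldMap (allVectors xs (suc j)) f ≈ foldMap xs (λ x → foldMap (allVectors xs j) (λ v → f (x ∷ᵛ v)))
  foldMap-allVectors-suc xs j f = trans (foldMap-concatMap _ xs f)
    (foldMap-cong xs (λ x → reflexive (foldMap-map (x ∷ᵛ_) (allVectors xs j) f)))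

  foldMap-allFin-sift : ∀ {n} (g : Fin n) (f : Fin n → A) → (∀ x → x ≢ g → f x ≈ ε) →
                        foldMap (allFin n) f ≈ f g
  foldMap-allFin-sift {suc n} zero f f≈ε = begin
    foldMap (allFin (suc n)) f            ≡⟨ foldMap-allFin-suc f ⟩
    f zero ∙ foldMap (allFin n) (f ∘ suc) ≈⟨ ∙-congˡ (foldMap-ε (allFin n) (λ x → f≈ε (suc x) λ ())) ⟩
    f zero ∙ ε                            ≈⟨ identityʳ _ ⟩
    f zero                                ∎
  foldMap-allFin-sift {suc n} (suc g) f f≈ε = begin
    foldMap (allFin (suc n)) f            ≡⟨ foldMap-allFin-suc f ⟩
    f zero ∙ foldMap (allFin n) (f ∘ suc) ≈⟨ ∙-cong (f≈ε zero λ ()) (foldMap-allFin-sift g (f ∘ suc) f∘suc≈ε) ⟩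
    ε ∙ f (suc g)                         ≈⟨ identityˡ _ ⟩
    f (suc g)                             ∎
    where
    f∘suc≈ε : ∀ x → x ≢ g → f (suc x) ≈ ε
    f∘suc≈ε x x≢g = f≈ε (suc x) (x≢g ∘ Fin.suc-injective)

  module _ {a r} (S : DecSetoid a r) where
    open DecSetoid S using (Carrier) renaming (_≈_ to _≋_; _≟_ to _≋?_)

    Sifting : List Carrier → Set _
    Sifting xs = ∀ g (f : Carrier → A) → (∀ x → ¬ x ≋ g → f x ≈ ε) → (∀ x → x ≋ g → f x ≈ f g) →
                 foldMap xs f ≈ f g

    module _ (xs : List Carrier) (sift : Sifting xs) where
      open DecSetoid S using () renaming (refl to ≋-refl; sym to ≋-sym; trans to ≋-trans)

      foldMap-sift-indicator : ∀ g (f : Carrier → A) → f Preserves _≋_ ⟶ _≈_ →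
                               foldMap xs (λ x → if does (x ≋? g) then f x else ε) ≈ f g
      foldMap-sift-indicator g f f-cong = trans (sift g _ outside inside) at-g
        where
        at-g : (if does (g ≋? g) then f g else ε) ≈ f g
        at-g = reflexive (if-yes (g ≋? g) ≋-refl)
        outside : ∀ x → ¬ x ≋ g → (if does (x ≋? g) then f x else ε) ≈ ε
        outside x x≉g = reflexive (if-no (x ≋? g) x≉g)
        inside : ∀ x → x ≋ g → (if does (x ≋? g) then f x else ε) ≈ (if does (g ≋? g) then f g else ε)
        inside x x≋g = trans (reflexive (if-yes (x ≋? g) x≋g)) (trans (f-cong x≋g) (sym at-g))

      foldMap-reindex : (φ ψ : Carrier → Carrier) →
                        φ Preserves _≋_ ⟶ _≋_ → ψ Preserves _≋_ ⟶ _≋_ →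
                        (∀ x → φ (ψ x) ≋ x) → (∀ x → ψ (φ x) ≋ x) →
                        (f : Carrier → A) → f Preserves _≋_ ⟶ _≈_ → foldMap xs (f ∘ φ) ≈ foldMap xs f
      foldMap-reindex φ ψ φ-cong ψ-cong φψ ψφ f f-cong = begin
        foldMap xs (f ∘ φ)                          ≈⟨ foldMap-cong xs (λ y → sym (foldMap-sift-indicator (φ y) f f-cong)) ⟩
        foldMap xs (λ y → foldMap xs (h y))         ≈⟨ foldMap-comm xs xs h ⟩
        foldMap xs (λ x → foldMap xs (λ y → h y x)) ≈⟨ foldMap-cong xs (λ x → foldMap-cong xs (swap-indicator x)) ⟩
        foldMap xs (λ x → foldMap xs (λ y → if does (y ≋? ψ x) then f x else ε))
          ≈⟨ foldMap-cong xs (λ x → foldMap-sift-indicator (ψ x) (λ _ → f x) (λ _ → ≈-refl)) ⟩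
        foldMap xs f                                ∎
        where
        h : Carrier → Carrier → A
        h y x = if does (x ≋? φ y) then f x else ε
        swap-indicator : ∀ x y → h y x ≈ (if does (y ≋? ψ x) then f x else ε)
        swap-indicator x y = reflexive (≡.cong (if_then f x else ε) (does-⇔ (mk⇔ to from) (x ≋? φ y) (y ≋? ψ x)))
          where
          to : x ≋ φ y → y ≋ ψ x
          to e = ≋-trans (≋-sym (ψφ y)) (ψ-cong (≋-sym e))
          from : y ≋ ψ x → x ≋ φ y
          from e = ≋-trans (≋-sym (φψ x)) (φ-cong (≋-sym e))

  allFin-sifting : ∀ {n} → Sifting (Fin.≡-decSetoid n) (allFin n)
  allFin-sifting g f outside _ = foldMap-allFin-sift g f outside

  allFuns-sifting : ∀ j p → Sifting (≗-decSetoid j p) (allFuns j p)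
  allFuns-sifting zero    p g f outside inside = trans (identityʳ _) (inside _ λ ())
  allFuns-sifting (suc j) p g f outside inside = begin
    foldMap (allFuns (suc j) p) f                       ≈⟨ foldMap-allVectors-suc (allFin p) j f ⟩
    foldMap (allFin p) (λ a → foldMap (allFuns j p) (λ v → f (a ∷ᵛ v)))
                                                        ≈⟨ foldMap-allFin-sift (g zero) _ other-heads ⟩
    foldMap (allFuns j p) (λ v → f (g zero ∷ᵛ v))       ≈⟨ allFuns-sifting j p (g ∘ suc) _ outside-tail inside-tail ⟩
    f (g zero ∷ᵛ g ∘ suc)                               ≈⟨ inside _ (cons-≗ (λ _ → refl)) ⟩
    f g                                                 ∎
    where
    cons-≗ : ∀ {v} → v ≗ g ∘ suc → (g zero ∷ᵛ v) ≗ g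
    cons-≗ v≗ zero    = refl
    cons-≗ v≗ (suc i) = v≗ i
    other-heads : ∀ a → a ≢ g zero → foldMap (allFuns j p) (λ v → f (a ∷ᵛ v)) ≈ ε
    other-heads a a≢ = foldMap-ε (allFuns j p) (λ v → outside (a ∷ᵛ v) (λ e → a≢ (e zero)))
    outside-tail : ∀ v → ¬ v ≗ g ∘ suc → f (g zero ∷ᵛ v) ≈ ε
    outside-tail v v≉ = outside _ (λ e → v≉ (e ∘ suc))
    inside-tail : ∀ v → v ≗ g ∘ suc → f (g zero ∷ᵛ v) ≈ f (g zero ∷ᵛ g ∘ suc)
    inside-tail v v≗ = trans (inside _ (cons-≗ v≗)) (sym (inside _ (cons-≗ (λ _ → refl))))

  module _ {n} {π : Fin n → Fin n} (π-injective : Injective _≡_ _≡_ π) where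

    foldMap-allFin-permute : ∀ (f : Fin n → A) → foldMap (allFin n) (f ∘ π) ≈ foldMap (allFin n) f
    foldMap-allFin-permute f = foldMap-reindex (Fin.≡-decSetoid n) (allFin n) allFin-sifting π (inverse π π-injective)
      (≡.cong π) (≡.cong (inverse π π-injective)) (inverseʳ π π-injective) (inverseˡ π π-injective) f (reflexive ∘ ≡.cong f)

    foldMap-allFuns-permute : ∀ {p} (f : (Fin n → Fin p) → A) → (∀ {σ σ′} → σ ≗ σ′ → f σ ≈ f σ′) →
                              foldMap (allFuns n p) (λ σ → f (σ ∘ π)) ≈ foldMap (allFuns n p) f
    foldMap-allFuns-permute {p} = foldMap-reindex (≗-decSetoid n p) (allFuns n p) (allFuns-sifting n p) (_∘ π) (_∘ π⁻¹)
      (λ e → e ∘ π) (λ e → e ∘ π⁻¹)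
      (λ σ → ≡.cong σ ∘ inverseˡ π π-injective) (λ σ → ≡.cong σ ∘ inverseʳ π π-injective)
      where π⁻¹ = inverse π π-injective

  foldMap-allFin-injection : ∀ {m n} (e : Fin m → Fin n) → Injective _≡_ _≡_ e → (f : Fin n → A) →
                             (∀ y → (∀ l → e l ≢ y) → f y ≈ ε) →
                             foldMap (allFin n) f ≈ foldMap (allFin m) (f ∘ e)
  foldMap-allFin-injection {m} {n} e e-injective f f≈ε = sym (begin
    foldMap (allFin m) (f ∘ e)                               ≈⟨ foldMap-cong (allFin m) (λ l → sym (sift-at-e l)) ⟩
    foldMap (allFin m) (λ l → foldMap (allFin n) (h l))      ≈⟨ foldMap-comm (allFin m) (allFin n) h ⟩
    foldMap (allFin n) (λ y → foldMap (allFin m) (λ l → h l y)) ≈⟨ foldMap-cong (allFin n) fibre ⟩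
    foldMap (allFin n) f                                     ∎)
    where
    h : Fin m → Fin n → A
    h l y = if does (y ≟ e l) then f y else ε
    sift-at-e : ∀ l → foldMap (allFin n) (h l) ≈ f (e l)
    sift-at-e l = foldMap-sift-indicator (Fin.≡-decSetoid n) (allFin n) allFin-sifting (e l) f (reflexive ∘ ≡.cong f)
    fibre : ∀ y → foldMap (allFin m) (λ l → h l y) ≈ f y
    fibre y with Fin.any? (λ l → e l ≟ y)
    ... | yes (l , refl) = foldMap-allFin-sift l _ (λ l′ l′≢l → reflexive (if-no (y ≟ e l′) (l′≢l ∘ e-injective ∘ ≡.sym)))
                           ⟨ trans ⟩ reflexive (if-yes (y ≟ e l) refl)
    ... | no ∄l = foldMap-ε (allFin m) (λ l → reflexive (if-no (y ≟ e l) (λ y≡ → ∄l (l , ≡.sym y≡))))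
                  ⟨ trans ⟩ sym (f≈ε y (λ l el≡y → ∄l (l , el≡y)))

  if-cong : ∀ b {x y} → x ≈ y → (if b then x else ε) ≈ (if b then y else ε)
  if-cong true  x≈y = x≈y
  if-cong false x≈y = ≈-refl

  if-∙ : ∀ b {x y} → (if b then x ∙ y else ε) ≈ (if b then x else ε) ∙ (if b then y else ε)
  if-∙ true  = ≈-refl
  if-∙ false = sym (identityˡ ε)

  module _ {n : ℕ} where

    foldMap² : (Fin n → Fin n → A) → A
    foldMap² h = foldMap (allFin n) (λ a → foldMap (allFin n) (h a))

    foldMap< : (Fin n → Fin n → A) → A
    foldMap< h = foldMap² (λ a b → if a <ᵇ b then h a b else ε)

    foldMap²-cong : ∀ {g h : Fin n → Fin n → A} → (∀ a b → g a b ≈ h a b) → foldMap² g ≈ foldMap² h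
    foldMap²-cong g≈h = foldMap-cong (allFin n) (λ a → foldMap-cong (allFin n) (g≈h a))

    foldMap²-∙ : ∀ (g h : Fin n → Fin n → A) → foldMap² (λ a b → g a b ∙ h a b) ≈ foldMap² g ∙ foldMap² h
    foldMap²-∙ g h = trans (foldMap-cong (allFin n) (λ a → foldMap-∙ (allFin n) (g a) (h a))) (foldMap-∙ (allFin n) _ _)

    foldMap²-transpose : ∀ (h : Fin n → Fin n → A) → foldMap² h ≈ foldMap² (λ a b → h b a)
    foldMap²-transpose = foldMap-comm (allFin n) (allFin n)

    foldMap<-cong : ∀ {g h : Fin n → Fin n → A} → (∀ a b → a <ᵇ b ≡ true → g a b ≈ h a b) → foldMap< g ≈ foldMap< h
    foldMap<-cong g≈h = foldMap²-cong pointwise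
      where
      pointwise : ∀ a b → (if a <ᵇ b then _ else ε) ≈ (if a <ᵇ b then _ else ε)
      pointwise a b with a <ᵇ b in a<b
      ... | true  = g≈h a b a<b
      ... | false = ≈-refl

    foldMap<-∙ : ∀ (g h : Fin n → Fin n → A) → foldMap< (λ a b → g a b ∙ h a b) ≈ foldMap< g ∙ foldMap< h
    foldMap<-∙ g h = trans (foldMap²-cong (λ a b → if-∙ (a <ᵇ b))) (foldMap²-∙ _ _)

    foldMap²-pairing : ∀ (h : Fin n → Fin n → A) →
      foldMap² h ≈ foldMap² (λ a b → (if a <ᵇ b then h a b ∙ h b a else ε) ∙ (if does (a ≟ b) then h a b else ε))
    foldMap²-pairing h = begin
      foldMap² h                                        ≈⟨ foldMap²-cong split ⟩
      foldMap² (λ a b → (below a b ∙ above a b) ∙ diagonal a b) ≈⟨ foldMap²-∙ _ diagonal ⟩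
      foldMap² (λ a b → below a b ∙ above a b) ∙ foldMap² diagonal ≈⟨ ∙-congʳ (foldMap²-∙ below above) ⟩
      (foldMap² below ∙ foldMap² above) ∙ foldMap² diagonal ≈⟨ ∙-congʳ (∙-congˡ (foldMap²-transpose above)) ⟩
      (foldMap² below ∙ foldMap² (λ a b → above b a)) ∙ foldMap² diagonal ≈⟨ ∙-congʳ (foldMap²-∙ below _) ⟨
      foldMap² (λ a b → below a b ∙ above b a) ∙ foldMap² diagonal ≈⟨ foldMap²-∙ _ diagonal ⟨
      foldMap² (λ a b → (below a b ∙ above b a) ∙ diagonal a b) ≈⟨ foldMap²-cong (λ a b → ∙-congʳ (sym (if-∙ (a <ᵇ b)))) ⟩
      foldMap² (λ a b → (if a <ᵇ b then h a b ∙ h b a else ε) ∙ diagonal a b) ∎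
      where
      below above diagonal : Fin n → Fin n → A
      below    a b = if a <ᵇ b then h a b else ε
      above    a b = if b <ᵇ a then h a b else ε
      diagonal a b = if does (a ≟ b) then h a b else ε
      split : ∀ a b → h a b ≈ (below a b ∙ above a b) ∙ diagonal a b
      split a b with Fin.<-cmp a b
      ... | tri< a<b _ b≮a rewrite dec-true (a <? b) a<b | dec-false (b <? a) b≮a | dec-false (a ≟ b) (Fin.<⇒≢ a<b) =
        sym (trans (identityʳ _) (identityʳ _))
      ... | tri≈ _ refl _  rewrite <ᵇ-irrefl a | dec-true (a ≟ a) refl =
        sym (trans (∙-congʳ (identityˡ ε)) (identityˡ _))
      ... | tri> a≮b _ b<a rewrite dec-false (a <? b) a≮b | dec-true (b <? a) b<a | dec-false (a ≟ b) (Fin.<⇒≢ b<a ∘ ≡.sym) =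
        sym (trans (identityʳ _) (identityˡ _))

    foldMap<-orientation : ∀ (h : Fin n → Fin n → A) → (∀ a b → a ≢ b → h b a ≈ h a b) →
                           (P : Fin n → Fin n → Bool) → (∀ a → P a a ≡ false) → (∀ a b → a ≢ b → P b a ≡ not (P a b)) →
                           foldMap² (λ a b → if P a b then h a b else ε) ≈ foldMap< h
    foldMap<-orientation h h-sym P P-irrefl P-flip =
      trans (foldMap²-pairing _) (foldMap²-cong oriented)
      where
      one-of-two : ∀ a b → a ≢ b → (if P a b then h a b else ε) ∙ (if P b a then h b a else ε) ≈ h a b
      one-of-two a b a≢b rewrite P-flip a b a≢b with P a b
      ... | true  = identityʳ _
      ... | false = trans (identityˡ _) (h-sym a b a≢b)
      oriented : ∀ a b → (if a <ᵇ b then (if P a b then h a b else ε) ∙ (if P b a then h b a else ε) else ε)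
                           ∙ (if does (a ≟ b) then (if P a b then h a b else ε) else ε)
                         ≈ (if a <ᵇ b then h a b else ε)
      oriented a b with Fin.<-cmp a b
      ... | tri< a<b _ _ rewrite dec-true (a <? b) a<b | dec-false (a ≟ b) (Fin.<⇒≢ a<b) =
        trans (identityʳ _) (one-of-two a b (Fin.<⇒≢ a<b))
      ... | tri≈ _ refl _ rewrite <ᵇ-irrefl a | dec-true (a ≟ a) refl | P-irrefl a = identityˡ ε
      ... | tri> a≮b _ b<a rewrite dec-false (a <? b) a≮b | dec-false (a ≟ b) (Fin.<⇒≢ b<a ∘ ≡.sym) = identityˡ ε

    foldMap<-permute : ∀ {π : Fin n → Fin n} → Injective _≡_ _≡_ π →
                       (h : Fin n → Fin n → A) → (∀ a b → a ≢ b → h b a ≈ h a b) →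
                       foldMap< (λ i j → h (π i) (π j)) ≈ foldMap< h
    foldMap<-permute {π} π-injective h h-sym = begin
      foldMap² (λ i j → if i <ᵇ j then h (π i) (π j) else ε)
        ≈⟨ foldMap²-cong (λ i j → reflexive (≡.cong₂ (λ u v → if u <ᵇ v then h (π i) (π j) else ε)
                                                    (≡.sym (inverseˡ π π-injective i)) (≡.sym (inverseˡ π π-injective j)))) ⟩
      foldMap (allFin n) (λ i → foldMap (allFin n) (λ j → oriented (π i) (π j)))
        ≈⟨ foldMap-cong (allFin n) (λ i → foldMap-allFin-permute π-injective (oriented (π i))) ⟩
      foldMap (allFin n) (λ i → foldMap (allFin n) (oriented (π i)))
        ≈⟨ foldMap-allFin-permute π-injective (λ a → foldMap (allFin n) (oriented a)) ⟩
      foldMap² oriented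
        ≈⟨ foldMap<-orientation h h-sym (λ a b → π⁻¹ a <ᵇ π⁻¹ b) (λ a → <ᵇ-irrefl (π⁻¹ a))
                                (λ a b a≢b → <ᵇ-flip (a≢b ∘ inverse-injective π π-injective)) ⟩
      foldMap< h ∎
      where
      π⁻¹ = inverse π π-injective
      oriented : Fin n → Fin n → A
      oriented a b = if π⁻¹ a <ᵇ π⁻¹ b then h a b else ε

module _ where
  open BigOperators ∧-commutativeMonoid

  ∧-≡true : ∀ {x y} → x ∧ y ≡ true ⇔ (x ≡ true × y ≡ true)
  ∧-≡true {true}  = mk⇔ (refl ,_) proj₂
  ∧-≡true {false} = mk⇔ (λ ()) (λ { (() , _) })

  allFin-∧-⇔ : ∀ {n} (f : Fin n → Bool) → foldMap (allFin n) f ≡ true ⇔ (∀ i → f i ≡ true)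
  allFin-∧-⇔ {zero}  f = mk⇔ (λ _ ()) (λ _ → refl)
  allFin-∧-⇔ {suc n} f rewrite foldMap-allFin-suc f = mk⇔
    (λ e → λ { zero → proj₁ (to ∧-≡true e) ; (suc i) → to (allFin-∧-⇔ (f ∘ suc)) (proj₂ (to ∧-≡true e)) i })
    (λ all → from ∧-≡true (all zero , from (allFin-∧-⇔ (f ∘ suc)) (all ∘ suc)))
    where open Equivalence

  and-allPairs-⇔ : ∀ {n} (E : Fin n → Fin n → Bool) →
                   and (concatMap (λ i → map (E i) (allFin n)) (allFin n)) ≡ true ⇔ (∀ i j → E i j ≡ true)
  and-allPairs-⇔ {n} E = mk⇔
    (λ e i → to (allFin-∧-⇔ (E i)) (to (allFin-∧-⇔ _) (≡.trans (≡.sym nested) e) i))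
    (λ all → ≡.trans nested (from (allFin-∧-⇔ _) (λ i → from (allFin-∧-⇔ (E i)) (all i))))
    where
    open Equivalence
    nested : and (concatMap (λ i → map (E i) (allFin n)) (allFin n)) ≡ foldMap (allFin n) (λ i → foldMap (allFin n) (E i))
    nested = ≡.trans (foldMap-concatMap _ (allFin n) id) (foldMap-cong (allFin n) (λ i → foldMap-map (E i) (allFin n) id))

reflects-≡ : ∀ {p q} {P : Set p} {Q : Set q} {b c : Bool} → b ≡ true ⇔ P → c ≡ true ⇔ Q → P ⇔ Q → b ≡ c
reflects-≡ b⇔P c⇔Q P⇔Q = ⇔→≡ (⇔.trans b⇔P (⇔.trans P⇔Q (⇔.sym c⇔Q)))

implication-⇔ : ∀ {p q} {P : Set p} {Q : Set q} (P? : Dec P) (Q? : Dec Q) →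
                not (does P?) ∨ does Q? ≡ true ⇔ (P → Q)
implication-⇔ (yes p) (yes q) = mk⇔ (λ _ _ → q) (λ _ → refl)
implication-⇔ (yes p) (no ¬q) = mk⇔ (λ ()) (λ p→q → ⊥-elim (¬q (p→q p)))
implication-⇔ (no ¬p) Q?      = mk⇔ (λ _ p → ⊥-elim (¬p p)) (λ _ → refl)

isInjectiveᵇ-⇔ : ∀ {a b} (σ : Fin a → Fin b) → isInjectiveᵇ σ ≡ true ⇔ Injective _≡_ _≡_ σ
isInjectiveᵇ-⇔ σ = mk⇔ (λ e {i} {j} → to (implication-⇔ (σ i ≟ σ j) (i ≟ j)) (to (and-allPairs-⇔ _) e i j))
                       (λ inj → from (and-allPairs-⇔ _) (λ i j → from (implication-⇔ (σ i ≟ σ j) (i ≟ j)) inj))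
  where open Equivalence

isInjectiveᵇ-cong : ∀ {a b} {σ σ′ : Fin a → Fin b} → σ ≗ σ′ → isInjectiveᵇ σ ≡ isInjectiveᵇ σ′
isInjectiveᵇ-cong σ≗σ′ = reflects-≡ (isInjectiveᵇ-⇔ _) (isInjectiveᵇ-⇔ _)
  (mk⇔ (injective-cong σ≗σ′) (injective-cong (≡.sym ∘ σ≗σ′)))

isInjectiveᵇ-∘ : ∀ {n p} (σ : Fin n → Fin p) {π : Fin n → Fin n} → Injective _≡_ _≡_ π →
                 isInjectiveᵇ (σ ∘ π) ≡ isInjectiveᵇ σ
isInjectiveᵇ-∘ σ {π} π-injective =
  reflects-≡ (isInjectiveᵇ-⇔ _) (isInjectiveᵇ-⇔ _) (mk⇔ undo-π (λ σ-injective e → π-injective (σ-injective e)))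
  where
  π⁻¹ = inverse π π-injective
  undo-π : Injective _≡_ _≡_ (σ ∘ π) → Injective _≡_ _≡_ σ
  undo-π σ∘π-injective = injective-cong (≡.cong σ ∘ inverseʳ π π-injective)
    (λ {x} {y} e → inverse-injective π π-injective (σ∘π-injective {π⁻¹ x} {π⁻¹ y} e))

isStrictIncᵇ-⇔ : ∀ {n p} (κ : Fin n → Fin p) → isStrictIncᵇ κ ≡ true ⇔ StrictlyIncreasing κ
isStrictIncᵇ-⇔ κ = mk⇔ (λ e {i} {j} → to (implication-⇔ (i <? j) (κ i <? κ j)) (to (and-allPairs-⇔ _) e i j))
                       (λ inc → from (and-allPairs-⇔ _) (λ i j → from (implication-⇔ (i <? j) (κ i <? κ j)) inc))
  where open Equivalence

isStrictIncᵇ-cong : ∀ {n p} {κ κ′ : Fin n → Fin p} → κ ≗ κ′ → isStrictIncᵇ κ ≡ isStrictIncᵇ κ′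
isStrictIncᵇ-cong κ≗κ′ = reflects-≡ (isStrictIncᵇ-⇔ _) (isStrictIncᵇ-⇔ _)
  (mk⇔ (strictlyIncreasing-cong κ≗κ′) (strictlyIncreasing-cong (≡.sym ∘ κ≗κ′)))

-- Sorting an injection

module Counting where
  open BigOperators ℕ.+-0-commutativeMonoid

  count : ∀ {n} → (Fin n → Bool) → ℕ
  count {n} P = foldMap (allFin n) (λ j → if P j then 1 else 0)

  count-suc : ∀ {n} (P : Fin (suc n) → Bool) → count P ≡ (if P zero then 1 else 0) ℕ.+ count (P ∘ suc)
  count-suc P = foldMap-allFin-suc (λ j → if P j then 1 else 0)

  count-cong : ∀ {n} {P Q : Fin n → Bool} → P ≗ Q → count P ≡ count Q
  count-cong {n} P≗Q = foldMap-cong (allFin n) (λ j → ≡.cong (if_then 1 else 0) (P≗Q j))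

  count-permute : ∀ {n} (P : Fin n → Bool) {π : Fin n → Fin n} → Injective _≡_ _≡_ π → count (P ∘ π) ≡ count P
  count-permute P π-injective = foldMap-allFin-permute π-injective (λ j → if P j then 1 else 0)

  count-<ᵇ : ∀ {n} (r : Fin n) → count (λ s → s <ᵇ r) ≡ toℕ r
  count-<ᵇ {suc n} zero    = ≡.trans (count-suc {n} (_<ᵇ zero)) (foldMap-ε (allFin n) (λ _ → refl))
  count-<ᵇ {suc n} (suc r) = ≡.trans (count-suc {n} (_<ᵇ suc r)) (≡.cong suc (count-<ᵇ r))

  private
    indicator-mono : ∀ {b b′} → (b ≡ true → b′ ≡ true) → (if b then 1 else 0) ℕ.≤ (if b′ then 1 else 0)
    indicator-mono {false}     _    = ℕ.z≤n
    indicator-mono {true}  b⇒b′ rewrite b⇒b′ refl = ℕ.≤-refl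

  count-mono : ∀ {n} {P Q : Fin n → Bool} → (∀ j → P j ≡ true → Q j ≡ true) → count P ℕ.≤ count Q
  count-mono {zero}          P⇒Q = ℕ.z≤n
  count-mono {suc n} {P} {Q} P⇒Q rewrite count-suc P | count-suc Q =
    ℕ.+-mono-≤ (indicator-mono (P⇒Q zero)) (count-mono (P⇒Q ∘ suc))

  count-mono-< : ∀ {n} {P Q : Fin n → Bool} → (∀ j → P j ≡ true → Q j ≡ true) →
                 ∀ j₀ → P j₀ ≡ false → Q j₀ ≡ true → count P ℕ.< count Q
  count-mono-< {suc n} {P} {Q} P⇒Q zero P≡false Q≡true rewrite count-suc P | count-suc Q | P≡false | Q≡true =
    ℕ.s≤s (count-mono (P⇒Q ∘ suc))
  count-mono-< {suc n} {P} {Q} P⇒Q (suc j₀) P≡false Q≡true rewrite count-suc P | count-suc Q =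
    ℕ.+-mono-≤-< (indicator-mono (P⇒Q zero)) (count-mono-< (P⇒Q ∘ suc) j₀ P≡false Q≡true)

  count-true : ∀ {n} → count {n} (λ _ → true) ≡ n
  count-true {zero}  = refl
  count-true {suc n} = ≡.trans (count-suc {n} (λ _ → true)) (≡.cong suc (count-true {n}))

module Sorting {n p} {l : Fin n → Fin p} (l-injective : Injective _≡_ _≡_ l) where
  open Counting

  rank : Fin n → ℕ
  rank i = count (λ j → l j <ᵇ l i)

  rank<n : ∀ i → rank i ℕ.< n
  rank<n i = ≡.subst (rank i ℕ.<_) count-true
    (count-mono-< (λ _ _ → refl) i (dec-false (l i <? l i) (Fin.<-irrefl refl)) refl)

  rank-mono : ∀ {i i′} → l i Fin.< l i′ → rank i ℕ.< rank i′
  rank-mono {i} {i′} li<li′ = count-mono-< (λ j lj<li → dec-true (l j <? l i′) (Fin.<-trans (does-true⇒ (l j <? l i) lj<li) li<li′))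
    i (dec-false (l i <? l i) (Fin.<-irrefl refl)) (dec-true (l i <? l i′) li<li′)

  sortPerm : Fin n → Fin n
  sortPerm i = Fin.fromℕ< (rank<n i)

  toℕ-sortPerm : ∀ i → toℕ (sortPerm i) ≡ rank i
  toℕ-sortPerm i = Fin.toℕ-fromℕ< (rank<n i)

  sortPerm-mono : ∀ {i i′} → l i Fin.< l i′ → sortPerm i Fin.< sortPerm i′
  sortPerm-mono {i} {i′} li<li′ =
    ≡.subst₂ ℕ._<_ (≡.sym (toℕ-sortPerm i)) (≡.sym (toℕ-sortPerm i′)) (rank-mono li<li′)

  sortPerm-injective : Injective _≡_ _≡_ sortPerm
  sortPerm-injective {i} {i′} e with Fin.<-cmp (l i) (l i′)
  ... | tri< li<li′ _ _ = ⊥-elim (Fin.<-irrefl e (sortPerm-mono li<li′))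
  ... | tri≈ _ li≡li′ _ = l-injective li≡li′
  ... | tri> _ _ li′<li = ⊥-elim (Fin.<-irrefl (≡.sym e) (sortPerm-mono li′<li))

  sorted : Fin n → Fin p
  sorted = l ∘ inverse sortPerm sortPerm-injective

  sorted-increasing : StrictlyIncreasing sorted
  sorted-increasing {r} {r′} r<r′ with Fin.<-cmp (sorted r) (sorted r′)
  ... | tri< lt _ _ = lt
  ... | tri≈ _ e _  = ⊥-elim (Fin.<-irrefl (inverse-injective sortPerm sortPerm-injective (l-injective e)) r<r′)
  ... | tri> _ _ gt = ⊥-elim (Fin.<-asym r<r′ (≡.subst₂ Fin._<_ (inverseʳ sortPerm _ r′) (inverseʳ sortPerm _ r)
                                                (sortPerm-mono gt)))

  l≗sorted∘sortPerm : l ≗ sorted ∘ sortPerm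
  l≗sorted∘sortPerm i = ≡.cong l (≡.sym (inverseˡ sortPerm sortPerm-injective i))

  module _ {κ : Fin n → Fin p} {τ : Fin n → Fin n} (κ-increasing : StrictlyIncreasing κ)
           (τ-injective : Injective _≡_ _≡_ τ) (l≗κ∘τ : l ≗ κ ∘ τ) where

    sortPerm-unique : τ ≗ sortPerm
    sortPerm-unique i = Fin.toℕ-injective (begin
      toℕ (τ i)                           ≡⟨ count-<ᵇ (τ i) ⟨
      count (_<ᵇ τ i)                     ≡⟨ count-permute (_<ᵇ τ i) τ-injective ⟨
      count (λ j → τ j <ᵇ τ i)            ≡⟨ count-cong (λ j → strictlyIncreasing-<ᵇ κ-increasing (τ j) (τ i)) ⟨
      count (λ j → κ (τ j) <ᵇ κ (τ i))    ≡⟨ count-cong (λ j → ≡.cong₂ _<ᵇ_ (l≗κ∘τ j) (l≗κ∘τ i)) ⟨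
      rank i                              ≡⟨ toℕ-sortPerm i ⟨
      toℕ (sortPerm i)                    ∎)
      where open ≡.≡-Reasoning

    sorted-unique : κ ≗ sorted
    sorted-unique r = begin
      κ r                                         ≡⟨ ≡.cong κ (inverseʳ τ τ-injective r) ⟨
      κ (τ (inverse τ τ-injective r))             ≡⟨ l≗κ∘τ _ ⟨
      l (inverse τ τ-injective r)                 ≡⟨ ≡.cong l (sortPerm-injective same-image) ⟩
      sorted r                                    ∎
      where
      open ≡.≡-Reasoning
      same-image : sortPerm (inverse τ τ-injective r) ≡ sortPerm (inverse sortPerm sortPerm-injective r)
      same-image = ≡.trans (≡.sym (sortPerm-unique _))
                     (≡.trans (inverseʳ τ τ-injective r) (≡.sym (inverseʳ sortPerm sortPerm-injective r)))

-- Determinants and the Cauchy–Binet formula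

module Determinants {c ℓ} (R : CommutativeRing c ℓ) where
  open CommutativeRing R renaming (Carrier to C; refl to ≈-refl; zero to *-zero)
  open RingDefs R using (sign; det; DetF)
  open import Algebra.Properties.CommutativeSemigroup *-commutativeSemigroup using (x∙yz≈y∙xz; xy∙z≈y∙xz)
  module ∑ = BigOperators +-commutativeMonoid
  module ∏ = BigOperators *-commutativeMonoid
  open ≈-Reasoning setoid
  open import Algebra.Properties.Ring ring using (-1*x≈-x; -‿distribˡ-*)
  open import Algebra.Properties.Group +-group using (⁻¹-involutive; ε⁻¹≈ε)

  ∑-distribˡ : ∀ {a} {I : Set a} (xs : List I) k (f : I → C) → ∑.foldMap xs (λ x → k * f x) ≈ k * ∑.foldMap xs f
  ∑-distribˡ []       k f = sym (zeroʳ k)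
  ∑-distribˡ (x ∷ xs) k f = trans (+-congˡ (∑-distribˡ xs k f)) (sym (distribˡ k _ _))

  ∑-distribʳ : ∀ {a} {I : Set a} (xs : List I) k (f : I → C) → ∑.foldMap xs (λ x → f x * k) ≈ ∑.foldMap xs f * k
  ∑-distribʳ xs k f = trans (∑.foldMap-cong xs (λ x → *-comm _ _)) (trans (∑-distribˡ xs k f) (*-comm _ _))

  if-∑ : ∀ {a} {I : Set a} b (xs : List I) (f : I → C) →
         (if b then ∑.foldMap xs f else 0#) ≈ ∑.foldMap xs (λ x → if b then f x else 0#)
  if-∑ true  xs f = ≈-refl
  if-∑ false xs f = sym (∑.foldMap-ε xs (λ _ → ≈-refl))

  ∏∑≈∑∏ : ∀ {n p} (g : Fin n → Fin p → C) →
          ∏.foldMap (allFin n) (λ i → ∑.foldMap (allFin p) (g i)) ≈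
          ∑.foldMap (allFuns n p) (λ l → ∏.foldMap (allFin n) (λ i → g i (l i)))
  ∏∑≈∑∏ {zero}      g = sym (+-identityʳ 1#)
  ∏∑≈∑∏ {suc n} {p} g = begin
    ∏.foldMap (allFin (suc n)) (λ i → ∑.foldMap (allFin p) (g i))
      ≡⟨ ∏.foldMap-allFin-suc (λ i → ∑.foldMap (allFin p) (g i)) ⟩
    ∑.foldMap (allFin p) (g zero) * ∏.foldMap (allFin n) (λ i → ∑.foldMap (allFin p) (g (suc i)))
      ≈⟨ *-congˡ (∏∑≈∑∏ (g ∘ suc)) ⟩
    ∑.foldMap (allFin p) (g zero) * ∑.foldMap (allFuns n p) tail
      ≈⟨ ∑-distribʳ (allFin p) _ (g zero) ⟨
    ∑.foldMap (allFin p) (λ a → g zero a * ∑.foldMap (allFuns n p) tail)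
      ≈⟨ ∑.foldMap-cong (allFin p) (λ a → ∑-distribˡ (allFuns n p) (g zero a) tail) ⟨
    ∑.foldMap (allFin p) (λ a → ∑.foldMap (allFuns n p) (λ v → g zero a * tail v))
      ≈⟨ ∑.foldMap-cong (allFin p) (λ a → ∑.foldMap-cong (allFuns n p) (λ v →
           reflexive (∏.foldMap-allFin-suc (λ i → g i ((a ∷ᵛ v) i))))) ⟨
    ∑.foldMap (allFin p) (λ a → ∑.foldMap (allFuns n p) (λ v → ∏.foldMap (allFin (suc n)) (λ i → g i ((a ∷ᵛ v) i))))
      ≈⟨ ∑.foldMap-allVectors-suc (allFin p) n _ ⟨
    ∑.foldMap (allFuns (suc n) p) (λ l → ∏.foldMap (allFin (suc n)) (λ i → g i (l i))) ∎
    where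
    tail : (Fin n → Fin p) → C
    tail v = ∏.foldMap (allFin n) (λ i → g (suc i) (v i))

  module _ {n : ℕ} where

    ∑-perms : ∀ (f : (Fin n → Fin n) → C) →
              ∑.foldMap (perms n) f ≈ ∑.foldMap (allFuns n n) (λ σ → if isInjectiveᵇ σ then f σ else 0#)
    ∑-perms = ∑.foldMap-filterᵇ isInjectiveᵇ (allFuns n n)

    ∑-perms-cong : ∀ {f g : (Fin n → Fin n) → C} → (∀ σ → Injective _≡_ _≡_ σ → f σ ≈ g σ) →
                   ∑.foldMap (perms n) f ≈ ∑.foldMap (perms n) g
    ∑-perms-cong {f} {g} f≈g = trans (∑-perms f) (trans (∑.foldMap-cong (allFuns n n) pointwise) (sym (∑-perms g)))
      where
      pointwise : ∀ σ → (if isInjectiveᵇ σ then f σ else 0#) ≈ (if isInjectiveᵇ σ then g σ else 0#)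
      pointwise σ with isInjectiveᵇ σ in e
      ... | true  = f≈g σ (Equivalence.to (isInjectiveᵇ-⇔ σ) e)
      ... | false = ≈-refl

    ∑-perms-permute : ∀ {π : Fin n → Fin n} → Injective _≡_ _≡_ π → (f : (Fin n → Fin n) → C) →
                      (∀ {σ σ′} → σ ≗ σ′ → f σ ≈ f σ′) →
                      ∑.foldMap (perms n) (λ σ → f (σ ∘ π)) ≈ ∑.foldMap (perms n) f
    ∑-perms-permute {π} π-injective f f-cong = begin
      ∑.foldMap (perms n) (λ σ → f (σ ∘ π))                  ≈⟨ ∑-perms _ ⟩
      ∑.foldMap (allFuns n n) (λ σ → if isInjectiveᵇ σ then f (σ ∘ π) else 0#)
        ≈⟨ ∑.foldMap-cong (allFuns n n) (λ σ →
             reflexive (≡.cong (if_then f (σ ∘ π) else 0#) (≡.sym (isInjectiveᵇ-∘ σ π-injective)))) ⟩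
      ∑.foldMap (allFuns n n) (λ σ → restricted (σ ∘ π))
        ≈⟨ ∑.foldMap-allFuns-permute π-injective restricted restricted-cong ⟩
      ∑.foldMap (allFuns n n) restricted                      ≈⟨ ∑-perms f ⟨
      ∑.foldMap (perms n) f                                    ∎
      where
      restricted : (Fin n → Fin n) → C
      restricted σ = if isInjectiveᵇ σ then f σ else 0#
      restricted-cong : ∀ {σ σ′} → σ ≗ σ′ → restricted σ ≈ restricted σ′
      restricted-cong {σ} {σ′} σ≗σ′ = trans (reflexive (≡.cong (if_then f σ else 0#) (isInjectiveᵇ-cong σ≗σ′)))
                                            (∑.if-cong (isInjectiveᵇ σ′) (f-cong σ≗σ′))

  parity : Bool → C
  parity b = if b then - 1# else 1#

  parity-xor : ∀ x y → parity (x xor y) ≈ parity x * parity y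
  parity-xor true  true  = sym (trans (-1*x≈-x (- 1#)) (⁻¹-involutive 1#))
  parity-xor true  false = sym (*-identityʳ _)
  parity-xor false true  = sym (*-identityˡ _)
  parity-xor false false = sym (*-identityˡ _)

  parity² : ∀ b → parity b * parity b ≈ 1#
  parity² b = trans (sym (parity-xor b b)) (reflexive (≡.cong parity (xor-same b)))

  module _ {n : ℕ} where

    inverts : (Fin n → Fin n) → Fin n → Fin n → Bool
    inverts σ a b = (a <ᵇ b) xor (σ a <ᵇ σ b)

    inverts-sym : ∀ {σ} → Injective _≡_ _≡_ σ → ∀ a b → a ≢ b → inverts σ b a ≡ inverts σ a b
    inverts-sym {σ} σ-injective a b a≢b =
      ≡.trans (≡.cong₂ _xor_ (<ᵇ-flip a≢b) (<ᵇ-flip (a≢b ∘ σ-injective))) (not-xor-not (a <ᵇ b) (σ a <ᵇ σ b))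
      where
      not-xor-not : ∀ x y → not x xor not y ≡ x xor y
      not-xor-not true  y = refl
      not-xor-not false y = not-involutive y

    inverts-∘ : ∀ σ τ a b → inverts (σ ∘ τ) a b ≡ inverts τ a b xor inverts σ (τ a) (τ b)
    inverts-∘ σ τ a b = xor-chain (a <ᵇ b) (τ a <ᵇ τ b) (σ (τ a) <ᵇ σ (τ b))
      where
      xor-chain : ∀ x y z → x xor z ≡ (x xor y) xor (y xor z)
      xor-chain true  true  z = refl
      xor-chain true  false z = refl
      xor-chain false true  z = ≡.sym (not-involutive z)
      xor-chain false false z = refl

    sign-cong : ∀ {σ σ′ : Fin n → Fin n} → σ ≗ σ′ → sign σ ≈ sign σ′
    sign-cong σ≗σ′ = ∏.foldMap²-cong (λ i j →
      reflexive (≡.cong₂ (λ u v → if (i <ᵇ j) ∧ (u <ᵇ v) then - 1# else 1#) (σ≗σ′ j) (σ≗σ′ i)))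

    sign≈∏inverts : ∀ {σ} → Injective _≡_ _≡_ σ → sign σ ≈ ∏.foldMap< (λ a b → parity (inverts σ a b))
    sign≈∏inverts {σ} σ-injective = ∏.foldMap²-cong pointwise
      where
      pointwise : ∀ a b → parity ((a <ᵇ b) ∧ (σ b <ᵇ σ a)) ≈ (if a <ᵇ b then parity (inverts σ a b) else 1#)
      pointwise a b with a <ᵇ b in a<b
      ... | true  = reflexive (≡.cong parity (<ᵇ-flip (Fin.<⇒≢ (does-true⇒ (a <? b) a<b) ∘ σ-injective)))
      ... | false = ≈-refl

    sign-∘ : ∀ {σ τ} → Injective _≡_ _≡_ σ → Injective _≡_ _≡_ τ → sign (σ ∘ τ) ≈ sign σ * sign τ
    sign-∘ {σ} {τ} σ-injective τ-injective = begin
      sign (σ ∘ τ)                                                  ≈⟨ sign≈∏inverts (τ-injective ∘ σ-injective) ⟩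
      ∏.foldMap< (λ a b → parity (inverts (σ ∘ τ) a b))             ≈⟨ ∏.foldMap<-cong (λ a b _ → split a b) ⟩
      ∏.foldMap< (λ a b → parity (inverts τ a b) * parity (inverts σ (τ a) (τ b)))
        ≈⟨ ∏.foldMap<-∙ (λ a b → parity (inverts τ a b)) (λ a b → parity (inverts σ (τ a) (τ b))) ⟩
      ∏.foldMap< (λ a b → parity (inverts τ a b)) * ∏.foldMap< (λ a b → parity (inverts σ (τ a) (τ b)))
        ≈⟨ *-cong (sym (sign≈∏inverts τ-injective)) (∏.foldMap<-permute τ-injective _ σ-symmetric) ⟩
      sign τ * ∏.foldMap< (λ a b → parity (inverts σ a b))          ≈⟨ *-congˡ (sym (sign≈∏inverts σ-injective)) ⟩
      sign τ * sign σ                                               ≈⟨ *-comm _ _ ⟩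
      sign σ * sign τ                                               ∎
      where
      split : ∀ a b → parity (inverts (σ ∘ τ) a b) ≈ parity (inverts τ a b) * parity (inverts σ (τ a) (τ b))
      split a b = trans (reflexive (≡.cong parity (inverts-∘ σ τ a b))) (parity-xor _ _)
      σ-symmetric : ∀ a b → a ≢ b → parity (inverts σ b a) ≈ parity (inverts σ a b)
      σ-symmetric a b a≢b = reflexive (≡.cong parity (inverts-sym σ-injective a b a≢b))

    sign²≈1 : ∀ σ → sign σ * sign σ ≈ 1#
    sign²≈1 σ = trans (sym (∏.foldMap²-∙ entry entry))
                      (∏.foldMap-ε (allFin n) (λ i → ∏.foldMap-ε (allFin n) (λ j → parity² _)))
      where
      entry : Fin n → Fin n → C
      entry i j = parity ((i <ᵇ j) ∧ (σ j <ᵇ σ i))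

  sign-swap01 : ∀ {n} → sign (swap01 {n}) ≈ - 1#
  sign-swap01 {n} = begin
    sign (swap01 {n})                                      ≡⟨ ∏.foldMap-allFin-suc row ⟩
    row zero * ∏.foldMap (allFin (suc n)) (row ∘ Fin.suc)  ≈⟨ *-cong first-row (∏.foldMap-ε (allFin (suc n)) other-rows) ⟩
    - 1# * 1#                                              ≈⟨ *-identityʳ _ ⟩
    - 1#                                                   ∎
    where
    entry : Fin (suc (suc n)) → Fin (suc (suc n)) → C
    entry i j = parity ((i <ᵇ j) ∧ (swap01 j <ᵇ swap01 i))
    row : Fin (suc (suc n)) → C
    row i = ∏.foldMap (allFin (suc (suc n))) (entry i)
    ones : ∀ {m} (f : Fin m → C) → (∀ j → f j ≡ 1#) → ∏.foldMap (allFin m) f ≈ 1#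
    ones {m} f f≡1 = ∏.foldMap-ε (allFin m) (reflexive ∘ f≡1)
    first-row : row zero ≈ - 1#
    first-row = begin
      row zero                                                      ≡⟨ ∏.foldMap-allFin-suc (entry zero) ⟩
      1# * ∏.foldMap (allFin (suc n)) (entry zero ∘ Fin.suc)        ≈⟨ *-identityˡ _ ⟩
      ∏.foldMap (allFin (suc n)) (entry zero ∘ Fin.suc)             ≡⟨ ∏.foldMap-allFin-suc (entry zero ∘ Fin.suc) ⟩
      - 1# * ∏.foldMap (allFin n) (entry zero ∘ Fin.suc ∘ Fin.suc)  ≈⟨ *-congˡ (ones (entry zero ∘ Fin.suc ∘ Fin.suc) λ _ → refl) ⟩
      - 1# * 1#                                                     ≈⟨ *-identityʳ _ ⟩
      - 1#                                                          ∎
    other-rows : ∀ i → row (suc i) ≈ 1#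
    other-rows zero    = ones (entry (suc zero)) λ { zero → refl ; (suc zero) → refl ; (suc (suc k)) → refl }
    other-rows (suc a) = ones (entry (suc (suc a)))
      λ { zero → refl ; (suc zero) → refl ; (suc (suc k)) → ≡.cong parity (<ᵇ-asym a k) }

  module _ {n : ℕ} where

    det-cong : ∀ {M M′ : Fin n → Fin n → C} → (∀ i j → M i j ≈ M′ i j) → det n M ≈ det n M′
    det-cong M≈M′ = ∑.foldMap-cong (perms n) (λ σ → *-congˡ (∏.foldMap-cong (allFin n) (λ i → M≈M′ i (σ i))))

    det-permuteRows : ∀ (M : Fin n → Fin n → C) {π : Fin n → Fin n} → Injective _≡_ _≡_ π →
                      det n (M ∘ π) ≈ sign π * det n M
    det-permuteRows M {π} π-injective = begin
      ∑.foldMap (perms n) (λ σ → sign σ * ∏.foldMap (allFin n) (λ i → M (π i) (σ i)))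
        ≈⟨ ∑.foldMap-cong (perms n) (λ σ → *-cong (sign-cong (λ i → ≡.cong σ (≡.sym (inverseˡ π π-injective i))))
                                                   (columns-moved σ)) ⟩
      ∑.foldMap (perms n) (λ σ → term (σ ∘ π⁻¹))
        ≈⟨ ∑-perms-permute (inverse-injective π π-injective) term term-cong ⟩
      ∑.foldMap (perms n) term
        ≈⟨ ∑-perms-cong (λ ρ ρ-injective →
             trans (*-congʳ (sign-∘ ρ-injective π-injective)) (trans (*-congʳ (*-comm _ _)) (*-assoc _ _ _))) ⟩
      ∑.foldMap (perms n) (λ ρ → sign π * (sign ρ * ∏.foldMap (allFin n) (λ i → M i (ρ i))))
        ≈⟨ ∑-distribˡ (perms n) (sign π) _ ⟩
      sign π * det n M ∎
      where
      π⁻¹ = inverse π π-injective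
      term : (Fin n → Fin n) → C
      term ρ = sign (ρ ∘ π) * ∏.foldMap (allFin n) (λ i → M i (ρ i))
      term-cong : ∀ {ρ ρ′} → ρ ≗ ρ′ → term ρ ≈ term ρ′
      term-cong ρ≗ρ′ = *-cong (sign-cong (ρ≗ρ′ ∘ π))
                              (∏.foldMap-cong (allFin n) (λ i → reflexive (≡.cong (M i) (ρ≗ρ′ i))))
      columns-moved : ∀ σ → ∏.foldMap (allFin n) (λ i → M (π i) (σ i)) ≈ ∏.foldMap (allFin n) (λ i → M i (σ (π⁻¹ i)))
      columns-moved σ = trans
        (∏.foldMap-cong (allFin n) (λ i → reflexive (≡.cong (M (π i) ∘ σ) (≡.sym (inverseˡ π π-injective i)))))
        (∏.foldMap-allFin-permute π-injective (λ i → M i (σ (π⁻¹ i))))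

  -- Pairing σ with σ ∘ swap01 cancels the terms two by two, so no division by 2 is needed.
  det-adjacentEqualRows : ∀ {n} (M : Fin (suc (suc n)) → Fin (suc (suc n)) → C) →
                          (∀ j → M zero j ≈ M (suc zero) j) → det (suc (suc n)) M ≈ 0#
  det-adjacentEqualRows {n} M row₀≈row₁ = begin
    ∑.foldMap (perms N) term
      ≈⟨ ∑-perms-cong split ⟩
    ∑.foldMap (perms N) (λ σ → ordered σ + reversed σ)
      ≈⟨ ∑.foldMap-∙ (perms N) ordered reversed ⟩
    ∑.foldMap (perms N) ordered + ∑.foldMap (perms N) reversed
      ≈⟨ +-congˡ (∑-perms-permute swap01-injective reversed reversed-cong) ⟨
    ∑.foldMap (perms N) ordered + ∑.foldMap (perms N) (λ σ → reversed (σ ∘ swap01))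
      ≈⟨ +-congˡ (∑-perms-cong reversed-swapped) ⟩
    ∑.foldMap (perms N) ordered + ∑.foldMap (perms N) (λ σ → - ordered σ)
      ≈⟨ ∑.foldMap-∙ (perms N) ordered _ ⟨
    ∑.foldMap (perms N) (λ σ → ordered σ - ordered σ)
      ≈⟨ ∑.foldMap-ε (perms N) (λ σ → -‿inverseʳ _) ⟩
    0# ∎
    where
    N = suc (suc n)
    term ordered reversed : (Fin N → Fin N) → C
    term σ = sign σ * ∏.foldMap (allFin N) (λ i → M i (σ i))
    ordered  σ = if σ zero <ᵇ σ (suc zero) then term σ else 0#
    reversed σ = if σ (suc zero) <ᵇ σ zero then term σ else 0#

    term-cong : ∀ {σ σ′} → σ ≗ σ′ → term σ ≈ term σ′
    term-cong σ≗σ′ = *-cong (sign-cong σ≗σ′) (∏.foldMap-cong (allFin N) (λ i → reflexive (≡.cong (M i) (σ≗σ′ i))))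

    reversed-cong : ∀ {σ σ′} → σ ≗ σ′ → reversed σ ≈ reversed σ′
    reversed-cong {σ} {σ′} σ≗σ′ = trans
      (reflexive (≡.cong (if_then term σ else 0#) (≡.cong₂ _<ᵇ_ (σ≗σ′ (suc zero)) (σ≗σ′ zero))))
      (∑.if-cong (σ′ (suc zero) <ᵇ σ′ zero) (term-cong σ≗σ′))

    split : ∀ σ → Injective _≡_ _≡_ σ → term σ ≈ ordered σ + reversed σ
    split σ σ-injective = trans (if-split (σ zero <ᵇ σ (suc zero)))
      (+-congˡ (reflexive (≡.cong (if_then term σ else 0#) (≡.sym (<ᵇ-flip (Fin.0≢1+n ∘ σ-injective))))))
      where
      if-split : ∀ b → term σ ≈ (if b then term σ else 0#) + (if not b then term σ else 0#)
      if-split true  = sym (+-identityʳ _)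
      if-split false = sym (+-identityˡ _)

    rows-swapped : ∀ i j → M (swap01 i) j ≈ M i j
    rows-swapped zero          j = sym (row₀≈row₁ j)
    rows-swapped (suc zero)    j = row₀≈row₁ j
    rows-swapped (suc (suc k)) j = ≈-refl

    term-swapped : ∀ σ → Injective _≡_ _≡_ σ → term (σ ∘ swap01) ≈ - term σ
    term-swapped σ σ-injective = begin
      sign (σ ∘ swap01) * ∏.foldMap (allFin N) (λ i → M i (σ (swap01 i)))
        ≈⟨ *-cong (sign-∘ σ-injective swap01-injective)
                  (∏.foldMap-cong (allFin N) (λ i → sym (rows-swapped i (σ (swap01 i))))) ⟩
      (sign σ * sign (swap01 {n})) * ∏.foldMap (allFin N) (λ i → M (swap01 i) (σ (swap01 i)))
        ≈⟨ *-cong (*-congˡ (sign-swap01 {n})) (∏.foldMap-allFin-permute swap01-injective (λ i → M i (σ i))) ⟩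
      (sign σ * - 1#) * ∏.foldMap (allFin N) (λ i → M i (σ i))
        ≈⟨ *-congʳ (trans (*-comm _ _) (-1*x≈-x _)) ⟩
      - sign σ * ∏.foldMap (allFin N) (λ i → M i (σ i))
        ≈⟨ -‿distribˡ-* _ _ ⟨
      - term σ ∎

    reversed-swapped : ∀ σ → Injective _≡_ _≡_ σ → reversed (σ ∘ swap01) ≈ - ordered σ
    reversed-swapped σ σ-injective =
      trans (∑.if-cong (σ zero <ᵇ σ (suc zero)) (term-swapped σ σ-injective)) (if-neg (σ zero <ᵇ σ (suc zero)))
      where
      if-neg : ∀ b → (if b then - term σ else 0#) ≈ - (if b then term σ else 0#)
      if-neg true  = ≈-refl
      if-neg false = sym ε⁻¹≈ε

  det-equalRows : ∀ {n} (M : Fin n → Fin n → C) {i j : Fin n} → i ≢ j → (∀ k → M i k ≈ M j k) → det n M ≈ 0#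
  det-equalRows {suc zero}    M {zero} {zero} i≢j _ = ⊥-elim (i≢j refl)
  det-equalRows {suc (suc n)} M {i}    {j}    i≢j rowᵢ≈rowⱼ = begin
    det N M                         ≈⟨ *-identityˡ _ ⟨
    1# * det N M                    ≈⟨ *-congʳ (sign²≈1 π) ⟨
    (sign π * sign π) * det N M     ≈⟨ *-assoc _ _ _ ⟩
    sign π * (sign π * det N M)     ≈⟨ *-congˡ (det-permuteRows M (pairPerm-injective i j)) ⟨
    sign π * det N (M ∘ π)          ≈⟨ *-congˡ (det-adjacentEqualRows (M ∘ π) row₀≈row₁) ⟩
    sign π * 0#                     ≈⟨ zeroʳ _ ⟩
    0#                              ∎
    where
    N = suc (suc n)
    π = pairPerm i j
    row₀≈row₁ : ∀ k → M (π zero) k ≈ M (π (suc zero)) k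
    row₀≈row₁ k rewrite pairPerm-zero i j i≢j | pairPerm-one i j = rowᵢ≈rowⱼ k

  module _ {n p : ℕ} (h : (Fin n → Fin p) → C) (h-cong : ∀ {l l′} → l ≗ l′ → h l ≈ h l′) where
    private
      infix 4 _≗?_
      _≗?_ = DecSetoid._≟_ (≗-decSetoid n p)

      Factorization : (Fin n → Fin p) → (Fin n → Fin p) → (Fin n → Fin n) → Set
      Factorization l κ τ = StrictlyIncreasing κ × Injective _≡_ _≡_ τ × l ≗ κ ∘ τ

      factorizationᵇ : (Fin n → Fin p) → (Fin n → Fin p) → (Fin n → Fin n) → Bool
      factorizationᵇ l κ τ = isStrictIncᵇ κ ∧ isInjectiveᵇ τ ∧ does (l ≗? κ ∘ τ)

      factorizationᵇ-⇔ : ∀ l κ τ → factorizationᵇ l κ τ ≡ true ⇔ Factorization l κ τ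
      factorizationᵇ-⇔ l κ τ = mk⇔
        (λ e → split (to ∧-≡true e))
        (λ (κ-inc , τ-inj , l≗) → from ∧-≡true (from (isStrictIncᵇ-⇔ κ) κ-inc ,
                                    from ∧-≡true (from (isInjectiveᵇ-⇔ τ) τ-inj , dec-true (l ≗? κ ∘ τ) l≗)))
        where
        open Equivalence
        split : isStrictIncᵇ κ ≡ true × isInjectiveᵇ τ ∧ does (l ≗? κ ∘ τ) ≡ true → Factorization l κ τ
        split (κ-inc , rest) with to ∧-≡true rest
        ... | τ-inj , l≗ = to (isStrictIncᵇ-⇔ κ) κ-inc , to (isInjectiveᵇ-⇔ τ) τ-inj , does-true⇒ (l ≗? κ ∘ τ) l≗

      kernel : (Fin n → Fin p) → (Fin n → Fin p) → (Fin n → Fin n) → C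
      kernel l κ τ = if factorizationᵇ l κ τ then h l else 0#

      kernel-≈h : ∀ {l κ τ} → Factorization l κ τ → kernel l κ τ ≈ h l
      kernel-≈h {l} {κ} {τ} f = reflexive (≡.cong (if_then h l else 0#) (Equivalence.from (factorizationᵇ-⇔ l κ τ) f))

      kernel-≈0 : ∀ {l κ τ} → ¬ Factorization l κ τ → kernel l κ τ ≈ 0#
      kernel-≈0 {l} {κ} {τ} ¬f =
        reflexive (≡.cong (if_then h l else 0#) (¬-not (¬f ∘ Equivalence.to (factorizationᵇ-⇔ l κ τ))))

      kernel-cong : ∀ l {κ κ′ τ τ′} → κ ≗ κ′ → τ ≗ τ′ → kernel l κ τ ≈ kernel l κ′ τ′
      kernel-cong l {κ} {κ′} {τ} {τ′} κ≗κ′ τ≗τ′ = reflexive (≡.cong (if_then h l else 0#)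
        (≡.cong₂ _∧_ (isStrictIncᵇ-cong κ≗κ′)
          (≡.cong₂ _∧_ (isInjectiveᵇ-cong τ≗τ′) (does-⇔ (mk⇔ to from) (l ≗? κ ∘ τ) (l ≗? κ′ ∘ τ′)))))
        where
        κ∘τ≗κ′∘τ′ : κ ∘ τ ≗ κ′ ∘ τ′
        κ∘τ≗κ′∘τ′ i = ≡.trans (≡.cong κ (τ≗τ′ i)) (κ≗κ′ (τ′ i))
        to : l ≗ κ ∘ τ → l ≗ κ′ ∘ τ′
        to l≗ i = ≡.trans (l≗ i) (κ∘τ≗κ′∘τ′ i)
        from : l ≗ κ′ ∘ τ′ → l ≗ κ ∘ τ
        from l≗ i = ≡.trans (l≗ i) (≡.sym (κ∘τ≗κ′∘τ′ i))

      fibre : ∀ l → ∑.foldMap (allFuns n p) (λ κ → ∑.foldMap (allFuns n n) (kernel l κ)) ≈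
                    (if isInjectiveᵇ l then h l else 0#)
      fibre l with isInjectiveᵇ l in l-injᵇ
      ... | false = ∑.foldMap-ε (allFuns n p) (λ κ → ∑.foldMap-ε (allFuns n n) (λ τ → kernel-≈0 {l} {κ} {τ} not-injective))
        where
        not-injective : ∀ {κ τ} → ¬ Factorization l κ τ
        not-injective (κ-inc , τ-inj , l≗) = case ≡.trans (≡.sym l-injᵇ) (Equivalence.from (isInjectiveᵇ-⇔ l)
          (λ {i} {j} li≡lj → τ-inj (strictlyIncreasing⇒injective κ-inc (≡.trans (≡.sym (l≗ i)) (≡.trans li≡lj (l≗ j))))))
          of λ ()
      ... | true = begin
        ∑.foldMap (allFuns n p) (λ κ → ∑.foldMap (allFuns n n) (kernel l κ))
          ≈⟨ ∑.allFuns-sifting n p sorted _ other-κ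
               (λ κ κ≗ → ∑.foldMap-cong (allFuns n n) (λ τ → kernel-cong l κ≗ (λ _ → refl))) ⟩
        ∑.foldMap (allFuns n n) (kernel l sorted)
          ≈⟨ ∑.allFuns-sifting n n sortPerm _ other-τ (λ τ τ≗ → kernel-cong l {sorted} {sorted} (λ _ → refl) τ≗) ⟩
        kernel l sorted sortPerm
          ≈⟨ kernel-≈h (sorted-increasing , sortPerm-injective , l≗sorted∘sortPerm) ⟩
        h l ∎
        where
        open Sorting (Equivalence.to (isInjectiveᵇ-⇔ l) l-injᵇ)
        other-κ : ∀ κ → ¬ κ ≗ sorted → ∑.foldMap (allFuns n n) (kernel l κ) ≈ 0#
        other-κ κ κ≉ = ∑.foldMap-ε (allFuns n n) (λ τ →
          kernel-≈0 (λ (κ-inc , τ-inj , l≗) → κ≉ (sorted-unique {κ} {τ} κ-inc τ-inj l≗)))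
        other-τ : ∀ τ → ¬ τ ≗ sortPerm → kernel l sorted τ ≈ 0#
        other-τ τ τ≉ = kernel-≈0 (λ (κ-inc , τ-inj , l≗) → τ≉ (sortPerm-unique {κ = sorted} {τ} κ-inc τ-inj l≗))

    ∑-increasing∘perms : ∑.foldMap (strictIncSeqs n p) (λ κ → ∑.foldMap (perms n) (λ τ → h (κ ∘ τ))) ≈
                   ∑.foldMap (allFuns n p) (λ l → if isInjectiveᵇ l then h l else 0#)
    ∑-increasing∘perms = begin
      ∑.foldMap (strictIncSeqs n p) (λ κ → ∑.foldMap (perms n) (λ τ → h (κ ∘ τ)))
        ≈⟨ ∑.foldMap-filterᵇ isStrictIncᵇ (allFuns n p) _ ⟩
      ∑.foldMap (allFuns n p) (λ κ → if isStrictIncᵇ κ then ∑.foldMap (perms n) (λ τ → h (κ ∘ τ)) else 0#)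
        ≈⟨ ∑.foldMap-cong (allFuns n p) (λ κ → ∑.if-cong (isStrictIncᵇ κ) (trans (∑-perms (λ τ → h (κ ∘ τ)))
             (∑.foldMap-cong (allFuns n n) (λ τ → ∑.if-cong (isInjectiveᵇ τ) (sym (sift-at (κ ∘ τ))))))) ⟩
      ∑.foldMap (allFuns n p) (λ κ → if isStrictIncᵇ κ then ∑.foldMap (allFuns n n) (λ τ →
        if isInjectiveᵇ τ then ∑.foldMap (allFuns n p) (λ l → if does (l ≗? κ ∘ τ) then h l else 0#) else 0#) else 0#)
        ≈⟨ ∑.foldMap-cong (allFuns n p) push ⟩
      ∑.foldMap (allFuns n p) (λ κ → ∑.foldMap (allFuns n n) (λ τ → ∑.foldMap (allFuns n p) (λ l → kernel l κ τ)))
        ≈⟨ ∑.foldMap-cong (allFuns n p) (λ κ → ∑.foldMap-comm (allFuns n n) (allFuns n p) _) ⟩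
      ∑.foldMap (allFuns n p) (λ κ → ∑.foldMap (allFuns n p) (λ l → ∑.foldMap (allFuns n n) (kernel l κ)))
        ≈⟨ ∑.foldMap-comm (allFuns n p) (allFuns n p) _ ⟩
      ∑.foldMap (allFuns n p) (λ l → ∑.foldMap (allFuns n p) (λ κ → ∑.foldMap (allFuns n n) (kernel l κ)))
        ≈⟨ ∑.foldMap-cong (allFuns n p) fibre ⟩
      ∑.foldMap (allFuns n p) (λ l → if isInjectiveᵇ l then h l else 0#) ∎
      where
      sift-at : ∀ g → ∑.foldMap (allFuns n p) (λ l → if does (l ≗? g) then h l else 0#) ≈ h g
      sift-at g = ∑.foldMap-sift-indicator (≗-decSetoid n p) (allFuns n p) (∑.allFuns-sifting n p) g h h-cong
      push : ∀ κ → (if isStrictIncᵇ κ then ∑.foldMap (allFuns n n) (λ τ →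
                      if isInjectiveᵇ τ then ∑.foldMap (allFuns n p) (λ l → if does (l ≗? κ ∘ τ) then h l else 0#) else 0#) else 0#)
                   ≈ ∑.foldMap (allFuns n n) (λ τ → ∑.foldMap (allFuns n p) (λ l → kernel l κ τ))
      push κ = trans (if-∑ (isStrictIncᵇ κ) (allFuns n n) _) (∑.foldMap-cong (allFuns n n) (λ τ →
        trans (∑.if-cong (isStrictIncᵇ κ) (if-∑ (isInjectiveᵇ τ) (allFuns n p) _))
        (trans (if-∑ (isStrictIncᵇ κ) (allFuns n p) _) (∑.foldMap-cong (allFuns n p) (λ l →
          reflexive (≡.sym (≡.trans (if-∧ (isStrictIncᵇ κ))
                                    (≡.cong (if isStrictIncᵇ κ then_else 0#) (if-∧ (isInjectiveᵇ τ))))))))))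

  cauchy-binet : ∀ {n p} (A : Fin n → Fin p → C) (B : Fin p → Fin n → C) →
    det n (λ i j → ∑.foldMap (allFin p) (λ l → A i l * B l j)) ≈
    ∑.foldMap (strictIncSeqs n p) (λ κ → det n (λ i j → A i (κ j)) * det n (λ i j → B (κ i) j))
  cauchy-binet {n} {p} A B = begin
    det n (λ i j → ∑.foldMap (allFin p) (λ l → A i l * B l j))
      ≈⟨ ∑.foldMap-cong (perms n) expand ⟩
    ∑.foldMap (perms n) (λ σ → ∑.foldMap (allFuns n p) (λ l → sign σ * (diagonal l * rows l σ)))
      ≈⟨ ∑.foldMap-comm (perms n) (allFuns n p) _ ⟩
    ∑.foldMap (allFuns n p) (λ l → ∑.foldMap (perms n) (λ σ → sign σ * (diagonal l * rows l σ)))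
      ≈⟨ ∑.foldMap-cong (allFuns n p) (λ l → trans (∑.foldMap-cong (perms n) (λ σ → x∙yz≈y∙xz _ _ _))
                                                   (∑-distribˡ (perms n) (diagonal l) _)) ⟩
    ∑.foldMap (allFuns n p) (λ l → diagonal l * det n (B ∘ l))
      ≈⟨ ∑.foldMap-cong (allFuns n p) non-injective-vanish ⟩
    ∑.foldMap (allFuns n p) (λ l → if isInjectiveᵇ l then diagonal l * det n (B ∘ l) else 0#)
      ≈⟨ ∑-increasing∘perms (λ l → diagonal l * det n (B ∘ l)) summand-cong ⟨
    ∑.foldMap (strictIncSeqs n p) (λ κ → ∑.foldMap (perms n) (λ τ → diagonal (κ ∘ τ) * det n (B ∘ κ ∘ τ)))
      ≈⟨ ∑.foldMap-cong (strictIncSeqs n p) (λ κ → ∑-perms-cong (λ τ τ-injective →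
           trans (*-congˡ (det-permuteRows (B ∘ κ) τ-injective)) (trans (x∙yz≈y∙xz _ _ _) (sym (*-assoc _ _ _))))) ⟩
    ∑.foldMap (strictIncSeqs n p) (λ κ → ∑.foldMap (perms n) (λ τ → (sign τ * diagonal (κ ∘ τ)) * det n (B ∘ κ)))
      ≈⟨ ∑.foldMap-cong (strictIncSeqs n p) (λ κ → ∑-distribʳ (perms n) (det n (B ∘ κ)) _) ⟩
    ∑.foldMap (strictIncSeqs n p) (λ κ → det n (λ i j → A i (κ j)) * det n (λ i j → B (κ i) j)) ∎
    where
    diagonal : (Fin n → Fin p) → C
    diagonal l = ∏.foldMap (allFin n) (λ i → A i (l i))
    rows : (Fin n → Fin p) → (Fin n → Fin n) → C
    rows l σ = ∏.foldMap (allFin n) (λ i → B (l i) (σ i))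
    summand-cong : ∀ {l l′} → l ≗ l′ → diagonal l * det n (B ∘ l) ≈ diagonal l′ * det n (B ∘ l′)
    summand-cong l≗l′ = *-cong (∏.foldMap-cong (allFin n) (λ i → reflexive (≡.cong (A i) (l≗l′ i))))
                               (det-cong (λ i j → reflexive (≡.cong (λ k → B k j) (l≗l′ i))))
    expand : ∀ σ → sign σ * ∏.foldMap (allFin n) (λ i → ∑.foldMap (allFin p) (λ l → A i l * B l (σ i))) ≈
                   ∑.foldMap (allFuns n p) (λ l → sign σ * (diagonal l * rows l σ))
    expand σ = trans (*-congˡ (trans (∏∑≈∑∏ (λ i l → A i l * B l (σ i)))
                                     (∑.foldMap-cong (allFuns n p) (λ l → ∏.foldMap-∙ (allFin n) _ _))))
                     (sym (∑-distribˡ (allFuns n p) (sign σ) _))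
    non-injective-vanish : ∀ l → diagonal l * det n (B ∘ l) ≈ (if isInjectiveᵇ l then diagonal l * det n (B ∘ l) else 0#)
    non-injective-vanish l with isInjectiveᵇ l in l-injᵇ
    ... | true  = ≈-refl
    ... | false with collision l (λ l-injective →
                       case ≡.trans (≡.sym l-injᵇ) (Equivalence.from (isInjectiveᵇ-⇔ l) l-injective) of λ ())
    ...   | i , j , i≢j , li≡lj =
      trans (*-congˡ (det-equalRows (B ∘ l) i≢j (λ k → reflexive (≡.cong (λ x → B x k) li≡lj)))) (zeroʳ _)

  module _ {n j : ℕ} (𝓕 : (Fin j → Perm n) → C) where

    DetF-cong : ∀ {M M′ : Fin n → Fin n → (Fin j → Fin n) → C} → (∀ i₁ i₂ is → M i₁ i₂ is ≈ M′ i₁ i₂ is) →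
                DetF n j 𝓕 M ≈ DetF n j 𝓕 M′
    DetF-cong M≈M′ = ∑.foldMap-cong (perms n) (λ σ → ∑.foldMap-cong (allVectors (perms n) j) (λ σs →
      *-congˡ (∏.foldMap-cong (allFin n) (λ i → M≈M′ i (σ i) (λ t → σs t i)))))

    DetF≈∑det : ∀ (M : Fin n → Fin n → (Fin j → Fin n) → C) →
                DetF n j 𝓕 M ≈ ∑.foldMap (allVectors (perms n) j) (λ σs → 𝓕 σs * det n (λ i i′ → M i i′ (λ t → σs t i)))
    DetF≈∑det M = trans (∑.foldMap-comm (perms n) (allVectors (perms n) j) _)
      (∑.foldMap-cong (allVectors (perms n) j) (λ σs →
        trans (∑.foldMap-cong (perms n) (λ σ → xy∙z≈y∙xz _ _ _)) (∑-distribˡ (perms n) (𝓕 σs) _)))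

    cauchy-binet-DetF : ∀ {p} (A : Fin n → Fin p → (Fin j → Fin n) → C) (B : Fin p → Fin n → C) →
      DetF n j 𝓕 (λ i₁ i₂ is → ∑.foldMap (allFin p) (λ l → A i₁ l is * B l i₂)) ≈
      ∑.foldMap (strictIncSeqs n p) (λ κ → DetF n j 𝓕 (λ i₁ i₂ is → A i₁ (κ i₂) is) * det n (λ i i′ → B (κ i) i′))
    cauchy-binet-DetF {p} A B = begin
      DetF n j 𝓕 (λ i₁ i₂ is → ∑.foldMap (allFin p) (λ l → A i₁ l is * B l i₂))
        ≈⟨ DetF≈∑det (λ i₁ i₂ is → ∑.foldMap (allFin p) (λ l → A i₁ l is * B l i₂)) ⟩
      ∑.foldMap Σs (λ σs → 𝓕 σs * det n (λ i i′ → ∑.foldMap (allFin p) (λ l → A i l (col σs i) * B l i′)))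
        ≈⟨ ∑.foldMap-cong Σs (λ σs → *-congˡ (cauchy-binet (λ i l → A i l (col σs i)) B)) ⟩
      ∑.foldMap Σs (λ σs → 𝓕 σs * ∑.foldMap Incs (λ κ → minorA σs κ * minorB κ))
        ≈⟨ ∑.foldMap-cong Σs (λ σs → ∑-distribˡ Incs (𝓕 σs) _) ⟨
      ∑.foldMap Σs (λ σs → ∑.foldMap Incs (λ κ → 𝓕 σs * (minorA σs κ * minorB κ)))
        ≈⟨ ∑.foldMap-comm Σs Incs _ ⟩
      ∑.foldMap Incs (λ κ → ∑.foldMap Σs (λ σs → 𝓕 σs * (minorA σs κ * minorB κ)))
        ≈⟨ ∑.foldMap-cong Incs (λ κ → trans (∑.foldMap-cong Σs (λ σs → sym (*-assoc _ _ _))) (∑-distribʳ Σs (minorB κ) _)) ⟩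
      ∑.foldMap Incs (λ κ → ∑.foldMap Σs (λ σs → 𝓕 σs * minorA σs κ) * minorB κ)
        ≈⟨ ∑.foldMap-cong Incs (λ κ → *-congʳ (DetF≈∑det (λ i₁ i₂ is → A i₁ (κ i₂) is))) ⟨
      ∑.foldMap Incs (λ κ → DetF n j 𝓕 (λ i₁ i₂ is → A i₁ (κ i₂) is) * minorB κ) ∎
      where
      Σs = allVectors (perms n) j
      Incs  = strictIncSeqs n p
      col : (Fin j → Perm n) → Fin n → Fin j → Fin n
      col σs i t = σs t i
      minorA : (Fin j → Perm n) → (Fin n → Fin p) → C
      minorA σs κ = det n (λ i i′ → A i (κ i′) (col σs i))
      minorB : (Fin n → Fin p) → C
      minorB κ = det n (λ i i′ → B (κ i) i′)

-- Incidence algebra of a finite meet semilattice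

module IncidenceAlgebra {c ℓ} (R : CommutativeRing c ℓ) {N : ℕ} (L : FinMeetSemilattice N) where
  open CommutativeRing R renaming (Carrier to C; refl to ≈-refl; zero to *-zero)
  open RingDefs.Lattice R L
  open FinMeetSemilattice L
  open IsMeetSemilattice isMeetSemilattice using (x∧y≤x; x∧y≤y; ∧-greatest; antisym)
    renaming (refl to ≤-refl; trans to ≤-trans)
  open Determinants R using (module ∑; ∑-distribʳ)
  open ≈-Reasoning setoid
  open import Algebra.Properties.CommutativeSemigroup *-commutativeSemigroup using (xy∙z≈xz∙y)

  ≤-meetAll-⇔ : ∀ {j} a (v : Fin j → Fin N) y → y ≤ meetAll a v ⇔ (y ≤ a × ∀ t → y ≤ v t)
  ≤-meetAll-⇔ {zero}  a v y = mk⇔ (_, λ ()) proj₁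
  ≤-meetAll-⇔ {suc j} a v y = mk⇔
    (λ y≤m → let y≤a⊓v₀ , y≤v∘suc = to (≤-meetAll-⇔ (a ⊓ v zero) (v ∘ Fin.suc) y) y≤m in
             ≤-trans y≤a⊓v₀ (x∧y≤x a (v zero)) ,
             λ { zero → ≤-trans y≤a⊓v₀ (x∧y≤y a (v zero)) ; (suc t) → y≤v∘suc t })
    (λ (y≤a , y≤v) → from (≤-meetAll-⇔ (a ⊓ v zero) (v ∘ Fin.suc) y) (∧-greatest y≤a (y≤v zero) , y≤v ∘ Fin.suc))
    where open Equivalence

  meetAll≤ : ∀ {j} a (v : Fin j → Fin N) → meetAll a v ≤ a
  meetAll≤ a v = proj₁ (Equivalence.to (≤-meetAll-⇔ a v (meetAll a v)) ≤-refl)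

  ≤-meetAll-⊓-⇔ : ∀ {j} a b (v : Fin j → Fin N) y → y ≤ meetAll (a ⊓ b) v ⇔ (y ≤ meetAll a v × y ≤ b)
  ≤-meetAll-⊓-⇔ a b v y = mk⇔
    (λ y≤m → let y≤a⊓b , y≤v = to (≤-meetAll-⇔ (a ⊓ b) v y) y≤m in
             from (≤-meetAll-⇔ a v y) (≤-trans y≤a⊓b (x∧y≤x a b) , y≤v) , ≤-trans y≤a⊓b (x∧y≤y a b))
    (λ (y≤m , y≤b) → let y≤a , y≤v = to (≤-meetAll-⇔ a v y) y≤m in
                     from (≤-meetAll-⇔ (a ⊓ b) v y) (∧-greatest y≤a y≤b , y≤v))
    where open Equivalence

  ζ-meetAll-⊓ : ∀ {j} a b (v : Fin j → Fin N) y → ζ y (meetAll (a ⊓ b) v) ≈ ζ y (meetAll a v) * ζ y b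
  ζ-meetAll-⊓ a b v y = trans
    (reflexive (≡.cong (if_then 1# else 0#)
      (does-⇔ (≤-meetAll-⊓-⇔ a b v y) (y ≤? meetAll (a ⊓ b) v) ((y ≤? meetAll a v) ×-dec (y ≤? b)))))
    (indicator-∧ (does (y ≤? meetAll a v)) (does (y ≤? b)))
    where
    indicator-∧ : ∀ x y → (if x ∧ y then 1# else 0#) ≈ (if x then 1# else 0#) * (if y then 1# else 0#)
    indicator-∧ true  y = sym (*-identityˡ _)
    indicator-∧ false y = sym (zeroˡ _)

  module _ (μ : Fin N → Fin N → C) (μ-mobius : IsMobius μ) where
    open IsMobius μ-mobius

    ∑μζ : Fin N → Fin N → C
    ∑μζ u w = ∑.foldMap elems (λ y → (if does (u ≤? y) then μ u y else 0#) * ζ y w)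

    ∑μζ-refl : ∀ w → ∑μζ w w ≈ 1#
    ∑μζ-refl w = trans (∑.foldMap-allFin-sift w _ off-diagonal) diagonal
      where
      diagonal : (if does (w ≤? w) then μ w w else 0#) * ζ w w ≈ 1#
      diagonal rewrite dec-true (w ≤? w) ≤-refl = trans (*-identityʳ _) (μ-refl w)
      off-diagonal : ∀ y → y ≢ w → (if does (w ≤? y) then μ w y else 0#) * ζ y w ≈ 0#
      off-diagonal y y≢w with w ≤? y | y ≤? w
      ... | yes w≤y | yes y≤w = ⊥-elim (y≢w (antisym y≤w w≤y))
      ... | yes _   | no  _   = zeroʳ _
      ... | no  _   | _       = zeroˡ _

    ∑μζ-≰ : ∀ u w → ¬ u ≤ w → ∑μζ u w ≈ 0#
    ∑μζ-≰ u w u≰w = ∑.foldMap-ε elems vanish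
      where
      vanish : ∀ y → (if does (u ≤? y) then μ u y else 0#) * ζ y w ≈ 0#
      vanish y with u ≤? y | y ≤? w
      ... | yes u≤y | yes y≤w = ⊥-elim (u≰w (≤-trans u≤y y≤w))
      ... | yes _   | no  _   = zeroʳ _
      ... | no  _   | _       = zeroˡ _

    ∑μζ-< : ∀ u w → u ≤ w → u ≢ w → ∑μζ u w ≈ 0#
    ∑μζ-< u w u≤w u≢w = begin
      ∑μζ u w                                              ≈⟨ ∑.foldMap-cong elems split ⟩
      ∑.foldMap elems (λ y → below y + at-w y)             ≈⟨ ∑.foldMap-∙ elems below at-w ⟩
      ∑.foldMap elems below + ∑.foldMap elems at-w
                                  ≈⟨ +-congˡ (∑.foldMap-allFin-sift w at-w (λ y y≢w → reflexive (if-no (y ≟ w) y≢w))) ⟩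
      ∑.foldMap elems below + at-w w                       ≈⟨ +-congˡ (reflexive (if-yes (w ≟ w) refl)) ⟩
      ∑.foldMap elems below + μ u w                        ≈⟨ +-congˡ (μ-lt u w u≤w u≢w) ⟩
      ∑.foldMap elems below - ∑.foldMap elems below        ≈⟨ -‿inverseʳ _ ⟩
      0#                                                   ∎
      where
      below at-w : Fin N → C
      below y = if does (u ≤? y) ∧ does (y ≤? w) ∧ not (does (y ≟ w)) then μ u y else 0#
      at-w  y = if does (y ≟ w) then μ u y else 0#
      split : ∀ y → (if does (u ≤? y) then μ u y else 0#) * ζ y w ≈ below y + at-w y
      split y with u ≤? y | y ≤? w | y ≟ w
      ... | yes _   | yes _   | yes _    = trans (*-identityʳ _) (sym (+-identityˡ _))
      ... | yes _   | yes _   | no  _    = trans (*-identityʳ _) (sym (+-identityʳ _))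
      ... | yes _   | no  y≰w | yes refl = ⊥-elim (y≰w ≤-refl)
      ... | yes _   | no  _   | no  _    = trans (zeroʳ _) (sym (+-identityʳ _))
      ... | no  u≰y | _       | yes refl = ⊥-elim (u≰y u≤w)
      ... | no  _   | _       | no  _    = trans (zeroˡ _) (sym (+-identityʳ _))

    ∑μζ≈δ : ∀ u w → ∑μζ u w ≈ (if does (u ≟ w) then 1# else 0#)
    ∑μζ≈δ u w with u ≟ w | u ≤? w
    ... | yes refl | _       = ∑μζ-refl u
    ... | no  u≢w  | yes u≤w = ∑μζ-< u w u≤w u≢w
    ... | no  _    | no  u≰w = ∑μζ-≰ u w u≰w

    möbius-inversion : ∀ (F : Fin N → C) w → F w ≈ ∑.foldMap elems (λ y → fFrom μ F y * ζ y w)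
    möbius-inversion F w = sym (begin
      ∑.foldMap elems (λ y → fFrom μ F y * ζ y w)
        ≈⟨ ∑.foldMap-cong elems (λ y → sym (∑-distribʳ elems (ζ y w) _)) ⟩
      ∑.foldMap elems (λ y → ∑.foldMap elems (λ u → (if does (u ≤? y) then μ u y * F u else 0#) * ζ y w))
        ≈⟨ ∑.foldMap-comm elems elems _ ⟩
      ∑.foldMap elems (λ u → ∑.foldMap elems (λ y → (if does (u ≤? y) then μ u y * F u else 0#) * ζ y w))
        ≈⟨ ∑.foldMap-cong elems (λ u →
             trans (∑.foldMap-cong elems (λ y → pull-out (does (u ≤? y)))) (∑-distribʳ elems (F u) _)) ⟩
      ∑.foldMap elems (λ u → ∑μζ u w * F u)
        ≈⟨ ∑.foldMap-cong elems (λ u → *-congʳ (∑μζ≈δ u w)) ⟩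
      ∑.foldMap elems (λ u → (if does (u ≟ w) then 1# else 0#) * F u)
        ≈⟨ ∑.foldMap-allFin-sift w _ (λ u u≢w → trans (*-congʳ (reflexive (if-no (u ≟ w) u≢w))) (zeroˡ _)) ⟩
      (if does (w ≟ w) then 1# else 0#) * F w
        ≈⟨ trans (*-congʳ (reflexive (if-yes (w ≟ w) refl))) (*-identityˡ _) ⟩
      F w ∎)
      where
      pull-out : ∀ {u y} b → (if b then μ u y * F u else 0#) * ζ y w ≈ ((if b then μ u y else 0#) * ζ y w) * F u
      pull-out true  = xy∙z≈xz∙y _ _ _
      pull-out false = trans (zeroˡ _) (sym (trans (*-congʳ (zeroˡ _)) (zeroˡ _)))

    expand-over-closure : ∀ {M} {xbar : Fin M → Fin N} → Injective _≡_ _≡_ xbar →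
      FactorClosed (λ y → ∃ λ l → y ≡ xbar l) → ∀ (G : Fin N → C) {a} → (∃ λ l → a ≡ xbar l) →
      ∀ b {j} (v : Fin j → Fin N) →
      G (meetAll (a ⊓ b) v) ≈ ∑.foldMap (allFin M) (λ l → (fFrom μ G (xbar l) * ζ (xbar l) (meetAll a v)) * ζ (xbar l) b)
    expand-over-closure {M} {xbar} xbar-injective closed G {a} a∈X̄ b v = begin
      G (meetAll (a ⊓ b) v)                                          ≈⟨ möbius-inversion G _ ⟩
      ∑.foldMap elems (λ y → fFrom μ G y * ζ y (meetAll (a ⊓ b) v))  ≈⟨ ∑.foldMap-cong elems split-ζ ⟩
      ∑.foldMap elems term                                           ≈⟨ ∑.foldMap-allFin-injection xbar xbar-injective term outside-X̄ ⟩
      ∑.foldMap (allFin M) (term ∘ xbar)                             ∎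
      where
      term : Fin N → C
      term y = (fFrom μ G y * ζ y (meetAll a v)) * ζ y b
      split-ζ : ∀ y → fFrom μ G y * ζ y (meetAll (a ⊓ b) v) ≈ term y
      split-ζ y = trans (*-congˡ (ζ-meetAll-⊓ a b v y)) (sym (*-assoc _ _ _))
      outside-X̄ : ∀ y → (∀ l → xbar l ≢ y) → term y ≈ 0#
      outside-X̄ y y∉X̄ with y ≤? meetAll a v
      ... | yes y≤m = ⊥-elim (let l , y≡xl = closed a∈X̄ (≤-trans y≤m (meetAll≤ a v)) in y∉X̄ l (≡.sym y≡xl))
      ... | no  _   = trans (*-congʳ (zeroʳ _)) (zeroˡ _)

open import Data.Nat using (_+_)

theorem3 : ∀ {c ℓ : Level} (R : CommutativeRing c ℓ) {N : ℕ} (L : FinMeetSemilattice N)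
    (μ : Fin N → Fin N → CommutativeRing.Carrier R) →
    RingDefs.Lattice.IsMobius R L μ →
    (n m : ℕ) (xbar : Fin (n + m) → Fin N) →
    Injective _≡_ _≡_ xbar →
    RingDefs.Lattice.IsFactorClosure R L n m xbar →
    (z : Fin n → Fin N) →
    (∀ i → ∃ λ j → z i ≡ xbar j) →
    (∀ i → FinMeetSemilattice._≤_ L (z i) (xbar (i ↑ˡ m))) →
    (F : Fin n → Fin N → CommutativeRing.Carrier R) →
    (j : ℕ) (𝓕 : (Fin j → Perm n) → CommutativeRing.Carrier R) →
    CommutativeRing._≈_ R
      (RingDefs.Lattice.DF R L n m xbar z F j 𝓕)
      (RingDefs.Lattice.RHS R L μ n m xbar z F j 𝓕)
theorem3 R {N} L μ μ-mobius n m xbar xbar-injective (xbar-factorClosed , _) z z∈X̄ _ F j 𝓕 = begin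
  DF n m xbar z F j 𝓕
    ≈⟨ DetF-cong 𝓕 (λ i₁ i₂ is →
         expand-over-closure μ μ-mobius xbar-injective xbar-factorClosed (F i₁) (z∈X̄ i₁) (xs i₂) (xs ∘ is)) ⟩
  DetF n j 𝓕 (λ i₁ i₂ is → ∑.foldMap (allFin (n + m)) (λ l → A i₁ l is * B l i₂))
    ≈⟨ cauchy-binet-DetF 𝓕 A B ⟩
  RHS μ n m xbar z F j 𝓕 ∎
  where
  open CommutativeRing R using (Carrier; _*_; setoid)
  open ≈-Reasoning setoid
  open RingDefs.Lattice R L using (DF; RHS; ζ; meetAll; fFrom)
  open Determinants R using (module ∑; DetF-cong; cauchy-binet-DetF)
  open IncidenceAlgebra R L using (expand-over-closure)
  open RingDefs R using (DetF)
  xs : Fin n → Fin N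
  xs i = xbar (i ↑ˡ m)
  A : Fin n → Fin (n + m) → (Fin j → Fin n) → Carrier
  A i l is = fFrom μ (F i) (xbar l) * ζ (xbar l) (meetAll (z i) (xs ∘ is))
  B : Fin (n + m) → Fin n → Carrier
  B l i = ζ (xbar l) (xs i)
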